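{- Let $a_1 \ge 2, a_2, \dots, a_s, q, n, r, t$ be positive integers. Run the following procedure (Algorithm B) with inputs $\mathcal{A}_1 = \mathcal{H}^t_{max}(a_1 - 1, a_2, \dots, a_s; q; n - r)$ and $\mathcal{A}_2 = \mathcal{H}^t_{max}(a_1 - 1, a_2, \dots, a_s; q - 1; n - 1)$, starting with $\mathcal{B} = \emptyset$: 1. Let $\mathcal{A}_1'$ be the set of all graphs $H \in \mathcal{H}^t_{+K_{q-1}}(a_1 - 1, a_2, \dots, a_s; q; n - r)$ that have no cone vertices (these can be obtained by removing edges from graphs in $\mathcal{A}_1$). 2. For each $H \in \mathcal{A}_1'$: (2.1) find the family $\mathcal{M}(H) = \{M_1,\dots,M_l\}$ of all maximal (under inclusion) subsets of $V(H)$ inducing a $K_{q-1}$-free subgraph; (2.2) find all $r$-element multisets $N = \{M_{i_1},\dots,M_{i_r}\}$ of elements of $\mathcal{M}(H)$ such that (a) for any two members $M_{i_j}, M_{i_k}$ of $N$, the subgraph of $H$ induced by $M_{i_j} \cap M_{i_k}$ contains a $K_{q-2}$, and (b) $\alpha\big(H - \bigcup_{M \in N'} M\big) \le t - |N'|$ for every sub-multiset $N'$ of $N$; (2.3) for each such $N$, construct $G = G(N)$ by adding to $H$ new pairwise non-adjacent vertices $v_1,\dots,v_r$ with $N_G(v_j) = M_{i_j}$, $j = 1,\dots,r$; if $\omega(G+e) = q$ for every edge $e$ of the complement of $G$, add $G$ to $\mathcal{B}$. 3. Remove isomorphic copies from $\mathcal{B}$. 4. Remove from $\mathcal{B}$ all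 graphs $G$ with $G \not\overset{v}{\rightarrow} (a_1, \dots, a_s)$. 5. If $t > r$: let $\mathcal{A}_1''$ be the set of graphs in $\mathcal{A}_1$ with exactly one cone vertex; for each such graph, written as $K_1 + H$, if $K_1 + H \overset{v}{\rightarrow} (a_1,\dots,a_s)$, add $\overline{K}_{r+1} + H$ to $\mathcal{B}$. 6. For each $H \in \mathcal{A}_2$ with $\alpha(H) \ge r$, if $K_1 + H \overset{v}{\rightarrow} (a_1,\dots,a_s)$, add $K_1 + H$ to $\mathcal{B}$. Then after the execution of this procedure, the set $\mathcal{B}$ coincides with the set of all graphs $G \in \mathcal{H}^t_{max}(a_1, \dots, a_s; q; n)$ with $\alpha(G) \ge r$.
   Context: All graphs are finite, simple and undirected; $\omega(G)$ is the clique number and $\alpha(G)$ the independence number; $N_G(v)$ is the neighbourhood of $v$. $G_1 + G_2$ denotes the join (disjoint union plus all edges between $G_1$ and $G_2$); $\overline{K}_k$ is the edgeless graph on $k$ vertices. A cone vertex is a vertex adjacent to all other vertices. $G \overset{v}{\rightarrow} (a_1, \dots, a_s)$ means that for every coloring of $V(G)$ in $s$ colors there is $i$ with a monochromatic $a_i$-clique of color $i$. $\mathcal{H}(a_1,\dots,a_s;q;n)$ is the set of $n$-vertex graphs $G$ with $G \overset{v}{\rightarrow} (a_1,\dots,a_s)$ and $\omega(G) < q$. A graph $G$ is a $(+K_k)$-graph if for every edge $e$ of the complement of $G$, $G + e$ contains a new $k$-clique. $\mathcal{H}_{+K_k}(a_1,\dots,a_s;q;n)$ is the set of $(+K_k)$-graphs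 in $\mathcal{H}(a_1,\dots,a_s;q;n)$, and $\mathcal{H}_{max}(a_1,\dots,a_s;q;n) = \mathcal{H}_{+K_q}(a_1,\dots,a_s;q;n)$ is the set of maximal $K_q$-free graphs in it. The superscript $t$, as in $\mathcal{H}^t_{max}$ and $\mathcal{H}^t_{+K_k}$, denotes the subset of graphs with independence number at most $t$. -}

module Defs where

open import Data.Nat using (ℕ; zero; suc; _+_; _∸_; _≤_; _<_)
open import Data.Bool using (Bool; true; false; _∧_; _∨_)
open import Data.Bool.Properties using (∨-comm; ∧-comm)
open import Data.Fin using (Fin; splitAt)
open import Data.Fin.Properties using (_≟_)
open import Data.Fin.Subset using (Subset; _∈_; _∉_; _⊆_; _⊂_; _∩_; ∣_∣)
open import Data.Vec using (Vec; _∷_; lookup)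
open import Data.Sum using (_⊎_; inj₁; inj₂)
open import Data.Product using (Σ; ∃; _×_; _,_)
open import Relation.Nullary using (¬_; yes; no)
open import Relation.Nullary.Decidable using (⌊_⌋)
open import Relation.Binary.PropositionalEquality using (_≡_; _≢_; refl; trans; cong₂)
open import Function.Bundles using (_↔_; Inverse)
open import Data.Empty using (⊥-elim)

record Graph (k : ℕ) : Set where
  field
    adj    : Fin k → Fin k → Bool
    adj-sym : ∀ x y → adj x y ≡ adj y x
    irrefl : ∀ x → adj x x ≡ false
open Graph public

Iso : ∀ {k k'} → Graph k → Graph k' → Set
Iso {k} {k'} G G' = Σ (Fin k ↔ Fin k') λ f →
  ∀ x y → adj G' (Inverse.to f x) (Inverse.to f y) ≡ adj G x y

IsClique : ∀ {k} → Graph k → Subset k → Set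
IsClique G S = ∀ x y → x ∈ S → y ∈ S → x ≢ y → adj G x y ≡ true

IsIndep : ∀ {k} → Graph k → Subset k → Set
IsIndep G S = ∀ x y → x ∈ S → y ∈ S → adj G x y ≡ false

OmegaLt : ∀ {k} → Graph k → ℕ → Set
OmegaLt G q = ∀ S → IsClique G S → ∣ S ∣ < q

OmegaEq : ∀ {k} → Graph k → ℕ → Set
OmegaEq G q = (∃ λ S → IsClique G S × ∣ S ∣ ≡ q) × (∀ S → IsClique G S → ∣ S ∣ ≤ q)

AlphaLe : ∀ {k} → Graph k → ℕ → Set
AlphaLe G t = ∀ S → IsIndep G S → ∣ S ∣ ≤ t

AlphaGe : ∀ {k} → Graph k → ℕ → Set
AlphaGe G r = ∃ λ S → IsIndep G S × r ≤ ∣ S ∣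

ContainsK : ∀ {k} → Graph k → ℕ → Subset k → Set
ContainsK G m M = ∃ λ S → S ⊆ M × IsClique G S × ∣ S ∣ ≡ m

Arrows : ∀ {k s} → Graph k → Vec ℕ s → Set
Arrows {k} {s} G as = (c : Fin k → Fin s) → ∃ λ i → ∃ λ S →
  IsClique G S × (∀ x → x ∈ S → c x ≡ i) × ∣ S ∣ ≡ lookup as i

pairB : ∀ {k} → Fin k → Fin k → Fin k → Fin k → Bool
pairB x y u v = (⌊ u ≟ x ⌋ ∧ ⌊ v ≟ y ⌋) ∨ (⌊ u ≟ y ⌋ ∧ ⌊ v ≟ x ⌋)

pairB-sym : ∀ {k} (x y u v : Fin k) → pairB x y u v ≡ pairB x y v u
pairB-sym x y u v = trans (∨-comm (⌊ u ≟ x ⌋ ∧ ⌊ v ≟ y ⌋) _)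
  (cong₂ _∨_ (∧-comm ⌊ u ≟ y ⌋ _) (∧-comm ⌊ u ≟ x ⌋ _))

pairB-irr : ∀ {k} (x y : Fin k) → x ≢ y → ∀ u → pairB x y u u ≡ false
pairB-irr x y ne u with u ≟ x | u ≟ y
... | yes refl | yes refl = ⊥-elim (ne refl)
... | yes _ | no _ = refl
... | no _ | yes _ = refl
... | no _ | no _ = refl

addEdge : ∀ {k} (G : Graph k) (x y : Fin k) → x ≢ y → Graph k
addEdge G x y ne = record
  { adj = λ u v → adj G u v ∨ pairB x y u v
  ; adj-sym = λ u v → cong₂ _∨_ (Graph.adj-sym G u v) (pairB-sym x y u v)
  ; irrefl = λ u → cong₂ _∨_ (irrefl G u) (pairB-irr x y ne u)
  }

PlusK : ∀ {k} → ℕ → Graph k → Set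
PlusK m G = ∀ x y → (ne : x ≢ y) → adj G x y ≡ false →
  ∃ λ S → IsClique (addEdge G x y ne) S × ∣ S ∣ ≡ m × ¬ IsClique G S

IsCone : ∀ {k} → Graph k → Fin k → Set
IsCone G v = ∀ w → w ≢ v → adj G v w ≡ true

NoCone : ∀ {k} → Graph k → Set
NoCone G = ∀ v → ¬ IsCone G v

ExactlyOneCone : ∀ {k} → Graph k → Set
ExactlyOneCone G = ∃ λ v → IsCone G v × (∀ w → IsCone G w → w ≡ v)

InH : ∀ {k s} → Vec ℕ s → ℕ → ℕ → Graph k → Set
InH {k} as q n G = k ≡ n × Arrows G as × OmegaLt G q

InHPlusT : ∀ {k s} → Vec ℕ s → ℕ → ℕ → ℕ → ℕ → Graph k → Set
InHPlusT as m q n t G = InH as q n G × PlusK m G × AlphaLe G t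

InHMaxT : ∀ {k s} → Vec ℕ s → ℕ → ℕ → ℕ → Graph k → Set
InHMaxT as q n t G = InHPlusT as q q n t G

joinAdj : ∀ {k m} → (Fin k → Fin k → Bool) → (Fin m → Fin m → Bool) →
          Fin k ⊎ Fin m → Fin k ⊎ Fin m → Bool
joinAdj f g (inj₁ x) (inj₁ y) = f x y
joinAdj f g (inj₁ x) (inj₂ y) = true
joinAdj f g (inj₂ x) (inj₁ y) = true
joinAdj f g (inj₂ x) (inj₂ y) = g x y

joinAdj-sym : ∀ {k m} (G : Graph k) (H : Graph m) u v →
  joinAdj (adj G) (adj H) u v ≡ joinAdj (adj G) (adj H) v u
joinAdj-sym G H (inj₁ x) (inj₁ y) = Graph.adj-sym G x y
joinAdj-sym G H (inj₁ x) (inj₂ y) = refl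
joinAdj-sym G H (inj₂ x) (inj₁ y) = refl
joinAdj-sym G H (inj₂ x) (inj₂ y) = Graph.adj-sym H x y

joinAdj-irr : ∀ {k m} (G : Graph k) (H : Graph m) u →
  joinAdj (adj G) (adj H) u u ≡ false
joinAdj-irr G H (inj₁ x) = irrefl G x
joinAdj-irr G H (inj₂ x) = irrefl H x

join : ∀ {k m} → Graph k → Graph m → Graph (k + m)
join {k} G H = record
  { adj = λ u v → joinAdj (adj G) (adj H) (splitAt k u) (splitAt k v)
  ; adj-sym = λ u v → joinAdj-sym G H (splitAt k u) (splitAt k v)
  ; irrefl = λ u → joinAdj-irr G H (splitAt k u)
  }

empty : (k : ℕ) → Graph k
empty k = record { adj = λ _ _ → false ; adj-sym = λ _ _ → refl ; irrefl = λ _ → refl }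

K1 : Graph 1
K1 = empty 1

extAdj : ∀ {k r} → Graph k → (Fin r → Subset k) →
         Fin k ⊎ Fin r → Fin k ⊎ Fin r → Bool
extAdj H Ms (inj₁ x) (inj₁ y) = adj H x y
extAdj H Ms (inj₁ x) (inj₂ j) = lookup (Ms j) x
extAdj H Ms (inj₂ j) (inj₁ y) = lookup (Ms j) y
extAdj H Ms (inj₂ i) (inj₂ j) = false

extAdj-sym : ∀ {k r} (H : Graph k) (Ms : Fin r → Subset k) u v →
  extAdj H Ms u v ≡ extAdj H Ms v u
extAdj-sym H Ms (inj₁ x) (inj₁ y) = Graph.adj-sym H x y
extAdj-sym H Ms (inj₁ x) (inj₂ j) = refl
extAdj-sym H Ms (inj₂ j) (inj₁ y) = refl
extAdj-sym H Ms (inj₂ i) (inj₂ j) = refl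

extAdj-irr : ∀ {k r} (H : Graph k) (Ms : Fin r → Subset k) u →
  extAdj H Ms u u ≡ false
extAdj-irr H Ms (inj₁ x) = irrefl H x
extAdj-irr H Ms (inj₂ j) = refl

extend : ∀ {k r} → Graph k → (Fin r → Subset k) → Graph (k + r)
extend {k} H Ms = record
  { adj = λ u v → extAdj H Ms (splitAt k u) (splitAt k v)
  ; adj-sym = λ u v → extAdj-sym H Ms (splitAt k u) (splitAt k v)
  ; irrefl = λ u → extAdj-irr H Ms (splitAt k u)
  }

MaxFree : ∀ {k} → Graph k → ℕ → Subset k → Set
MaxFree H q M = ¬ ContainsK H (q ∸ 1) M × (∀ M' → M ⊂ M' → ContainsK H (q ∸ 1) M')

-- conditions of step 2.2 on the r-element multiset N = {Ms 0, …, Ms (r-1)};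
-- sub-multisets N' are given by sets J of positions; α(H − ⋃N') ≤ t − |N'|
-- is written  α(H − ⋃N') + |N'| ≤ t  (integer subtraction)
ValidN : ∀ {k r} → Graph k → ℕ → ℕ → (Fin r → Subset k) → Set
ValidN {k} {r} H q t Ms =
  (∀ j → MaxFree H q (Ms j)) ×
  (∀ i j → i ≢ j → ContainsK H (q ∸ 2) (Ms i ∩ Ms j)) ×
  (∀ (J : Subset r) (S : Subset k) → IsIndep H S →
     (∀ x → x ∈ S → ∀ j → j ∈ J → x ∉ Ms j) → ∣ S ∣ + ∣ J ∣ ≤ t)

AllAddEdgeOmegaEq : ∀ {k} → Graph k → ℕ → Set
AllAddEdgeOmegaEq G q = ∀ x y → (ne : x ≢ y) → adj G x y ≡ false →
  OmegaEq (addEdge G x y ne) q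

-- the graphs put into B (steps 1-6; step 3 only removes isomorphic copies,
-- so B is considered up to isomorphism). Sequence  as = (a_2,…,a_s).
module AlgorithmB (a₁ : ℕ) {s : ℕ} (as : Vec ℕ s) (q n r t : ℕ) where

  full : Vec ℕ (suc s)
  full = a₁ ∷ as

  red : Vec ℕ (suc s)
  red = (a₁ ∸ 1) ∷ as

  data InB : ∀ {k} → Graph k → Set where
    step2 : ∀ {k} (H : Graph k) →
            InHPlusT red (q ∸ 1) q (n ∸ r) t H → NoCone H →
            (Ms : Fin r → Subset k) → ValidN H q t Ms →
            AllAddEdgeOmegaEq (extend H Ms) q →
            Arrows (extend H Ms) full →
            InB (extend H Ms)
    step5 : ∀ {k m} (F : Graph k) (H : Graph m) → r < t →
            InHMaxT red q (n ∸ r) t F → ExactlyOneCone F →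
            Iso F (join K1 H) → Arrows (join K1 H) full →
            InB (join (empty (suc r)) H)
    step6 : ∀ {m} (H : Graph m) →
            InHMaxT red (q ∸ 1) (n ∸ 1) t H → AlphaGe H r →
            Arrows (join K1 H) full →
            InB (join K1 H)

-- If G has a cone vertex v, then G = K₁ + (G − v) with G − v maximal K_{q−1}-free and arrowing
-- (a₁ − 1, a₂, …, a_s): step 6. Otherwise fix an independent r-set A and H = G − A, so that G = G(N) for the family N
-- of neighbourhoods of the vertices of A. If H has no cone vertex, maximality of G makes each neighbourhood a maximal
-- K_{q−1}-free set, makes any two of them share a K_{q−2}, and turns α(G) ≤ t into condition (b): step 2. If H has a
-- cone vertex w, it has a non-neighbour in A because G has none; in a maximal K_q-free graph a vertex whose
-- neighbourhood contains that of a non-adjacent vertex has the same neighbourhood, so A ∪ {w} is an independent set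
-- joined to everything else, G = K̄ᵣ₊₁ + H′, and contracting K̄ᵣ₊₁ to a single vertex gives a graph of
-- H^t_max(a₁ − 1, a₂, …, a_s; q; n − r) with exactly one cone vertex: step 5. Each construction transfers clique
-- number, maximality, arrowing and independence number in both directions, which gives the converse.

module Submission where

open import Defs
open import Data.Nat using (ℕ; _≤_)
open import Data.Vec using (Vec; _∷_)
open import Data.Vec.Relation.Unary.All using (All)
open import Data.Product using (Σ; ∃; _×_)
open import Function.Bundles using (_⇔_)

open import Data.Nat using (zero; suc; _+_; _∸_; _<_; z≤n; s≤s)
import Data.Nat.Properties as ℕ
open import Data.Bool using (Bool; true; false; _∧_; _∨_)
import Data.Bool.Properties
open import Data.Fin using (Fin; splitAt; _↑ˡ_; _↑ʳ_)
import Data.Fin as Fin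
import Data.Fin.Properties as Fin
open import Data.Fin.Subset
open import Data.Fin.Subset.Properties
open import Data.Vec using ([]; lookup; tabulate; here; there; _++_)
import Data.Vec.Properties as Vec
open import Data.Vec.Relation.Unary.All.Properties using (lookup⁺)
open import Data.Sum using (_⊎_; inj₁; inj₂; swap; [_,_]′)
import Data.Sum
open import Data.Sum.Properties using (swap-↔)
open import Data.Product using (_,_; proj₁; proj₂)
open import Relation.Nullary using (¬_; yes; no; contradiction)
open import Relation.Nullary.Decidable using (Dec; ⌊_⌋; dec-true; isYes≗does; ¬?; _×-dec_; _→-dec_; decidable-stable)
open import Relation.Binary.PropositionalEquality hiding (J)
open import Function using (_∘_; flip; id; case_of_)
open import Function.Bundles using (Inverse; _↔_; mk↔ₛ′; mk⇔)
open import Function.Properties.Inverse using (↔-sym; ↔-refl; ↔-trans)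

private variable
  n m k k′ p : ℕ

∈-tabulate⁺ : (f : Fin n → Bool) {x : Fin n} → f x ≡ true → x ∈ tabulate f
∈-tabulate⁺ f {x} fx = Vec.lookup⇒[]= x (tabulate f) (trans (Vec.lookup∘tabulate f x) fx)

∈-tabulate⁻ : (f : Fin n → Bool) {x : Fin n} → x ∈ tabulate f → f x ≡ true
∈-tabulate⁻ f {x} x∈ = trans (sym (Vec.lookup∘tabulate f x)) (Vec.[]=⇒lookup x∈)

x∉p⇒lookup≡false : (p : Subset n) {x : Fin n} → x ∉ p → lookup p x ≡ false
x∉p⇒lookup≡false p {x} x∉p with lookup p x in eq
... | true = contradiction (Vec.lookup⇒[]= x p eq) x∉p
... | false = refl

∣p∣≤∣q∣-injection : (f : Fin n → Fin m) (p : Subset n) (q : Subset m) →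
  (∀ {x y} → x ∈ p → y ∈ p → f x ≡ f y → x ≡ y) → (∀ {x} → x ∈ p → f x ∈ q) →
  ∣ p ∣ ≤ ∣ q ∣
∣p∣≤∣q∣-injection f [] q inj into = z≤n
∣p∣≤∣q∣-injection f (outside ∷ p) q inj into =
  ∣p∣≤∣q∣-injection (f ∘ Fin.suc) p q
    (λ x∈p y∈p e → Fin.suc-injective (inj (there x∈p) (there y∈p) e)) (into ∘ there)
∣p∣≤∣q∣-injection f (inside ∷ p) q inj into = ℕ.≤-trans
  (s≤s (∣p∣≤∣q∣-injection (f ∘ Fin.suc) p (q - f Fin.zero)
    (λ x∈p y∈p e → Fin.suc-injective (inj (there x∈p) (there y∈p) e))
    (λ x∈p → x∈p∧x≢y⇒x∈p-y (into (there x∈p)) (λ e → case inj (there x∈p) here e of λ ()))))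
  (x∈p⇒∣p-x∣<∣p∣ (into here))

x∉p-x : (p : Subset n) (x : Fin n) → x ∉ p - x
x∉p-x (_ ∷ p) (Fin.suc x) (there x∈) = x∉p-x p x x∈

∈p-x⇒≢ : {p : Subset n} {x y : Fin n} → y ∈ p - x → y ≢ x
∈p-x⇒≢ {p = p} y∈ refl = x∉p-x p _ y∈

∣p∣≤1+∣p-x∣ : (p : Subset n) (x : Fin n) → ∣ p ∣ ≤ suc ∣ p - x ∣
∣p∣≤1+∣p-x∣ (inside ∷ p) Fin.zero = s≤s (ℕ.≤-reflexive (cong ∣_∣ (sym (p─⊥≡p p))))
∣p∣≤1+∣p-x∣ (outside ∷ p) Fin.zero = ℕ.≤-trans (ℕ.≤-reflexive (cong ∣_∣ (sym (p─⊥≡p p)))) (ℕ.n≤1+n _)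
∣p∣≤1+∣p-x∣ (inside ∷ p) (Fin.suc x) = s≤s (∣p∣≤1+∣p-x∣ p x)
∣p∣≤1+∣p-x∣ (outside ∷ p) (Fin.suc x) = ∣p∣≤1+∣p-x∣ p x

∣x∷p∣≤1+∣p∣ : (b : Side) (p : Subset k) → ∣ b ∷ p ∣ ≤ suc ∣ p ∣
∣x∷p∣≤1+∣p∣ inside p = ℕ.≤-refl
∣x∷p∣≤1+∣p∣ outside p = ℕ.n≤1+n _

∣p∣≤1+∣q∣ : {p q : Subset n} (x : Fin n) → (∀ {y} → y ∈ p → y ≢ x → y ∈ q) → ∣ p ∣ ≤ suc ∣ q ∣
∣p∣≤1+∣q∣ {p = p} x p⊆q∪x = ℕ.≤-trans (∣p∣≤1+∣p-x∣ p x)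
  (s≤s (p⊆q⇒∣p∣≤∣q∣ (λ y∈ → p⊆q∪x (p─q⊆p p ⁅ x ⁆ y∈) (∈p-x⇒≢ {p = p} y∈))))

Empty⇒∣p∣≡0 : {p : Subset n} → Empty p → ∣ p ∣ ≡ 0
Empty⇒∣p∣≡0 {n} e = trans (cong ∣_∣ (Empty-unique e)) (∣⊥∣≡0 n)

∣p∣≤1 : {p : Subset n} → (∀ {x y} → x ∈ p → y ∈ p → x ≡ y) → ∣ p ∣ ≤ 1
∣p∣≤1 {n} {p} unique with nonempty? p
... | yes (x , x∈p) = ℕ.≤-trans (∣p∣≤1+∣q∣ {q = ⊥} x (λ y∈p y≢x → contradiction (unique y∈p x∈p) y≢x))
                                (s≤s (ℕ.≤-reflexive (∣⊥∣≡0 n)))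
... | no ¬ne = ℕ.≤-trans (ℕ.≤-reflexive (Empty⇒∣p∣≡0 ¬ne)) z≤n

∣p∣≤2 : {p : Subset n} (x y : Fin n) → (∀ {z} → z ∈ p → z ≡ x ⊎ z ≡ y) → ∣ p ∣ ≤ 2
∣p∣≤2 x y p⊆xy = ℕ.≤-trans
  (∣p∣≤1+∣q∣ x (λ z∈p z≢x → [ flip contradiction z≢x , (λ { refl → x∈⁅x⁆ y }) ]′ (p⊆xy z∈p)))
  (s≤s (ℕ.≤-reflexive (∣⁅x⁆∣≡1 y)))

pair : Fin n → Fin n → Subset n
pair x y = ⁅ x ⁆ ∪ ⁅ y ⁆

x∈pair : (x y : Fin n) → x ∈ pair x y
x∈pair x y = x∈p∪q⁺ (inj₁ (x∈⁅x⁆ x))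

y∈pair : (x y : Fin n) → y ∈ pair x y
y∈pair x y = x∈p∪q⁺ (inj₂ (x∈⁅x⁆ y))

∈pair⇒ : {x y z : Fin n} → z ∈ pair x y → z ≡ x ⊎ z ≡ y
∈pair⇒ {x = x} {y} z∈ = Data.Sum.map (x∈⁅y⁆⇒x≡y x) (x∈⁅y⁆⇒x≡y y) (x∈p∪q⁻ ⁅ x ⁆ ⁅ y ⁆ z∈)

∣pair∣≡2 : {x y : Fin n} → x ≢ y → ∣ pair x y ∣ ≡ 2
∣pair∣≡2 {x = x} {y} x≢y = ℕ.≤-antisym (∣p∣≤2 x y ∈pair⇒) (ℕ.≤-trans
  (s≤s (ℕ.≤-trans (ℕ.≤-reflexive (sym (∣⁅x⁆∣≡1 y)))
    (p⊆q⇒∣p∣≤∣q∣ (λ z∈y → subst (_∈ pair x y - x) (sym (x∈⁅y⁆⇒x≡y y z∈y))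
      (x∈p∧x≢y⇒x∈p-y (y∈pair x y) (x≢y ∘ sym))))))
  (x∈p⇒∣p-x∣<∣p∣ (x∈pair x y)))

∃-⊆-between : (p q : Subset n) (k : ℕ) → p ⊆ q → ∣ p ∣ ≤ k → k ≤ ∣ q ∣ →
  ∃ λ r → p ⊆ r × r ⊆ q × ∣ r ∣ ≡ k
∃-⊆-between [] [] zero _ _ _ = [] , (λ ()) , (λ ()) , refl
∃-⊆-between (inside ∷ p) (outside ∷ q) k p⊆q _ _ with () ← p⊆q here
∃-⊆-between (outside ∷ p) (outside ∷ q) k p⊆q lo hi
  with r , p⊆r , r⊆q , ∣r∣ ← ∃-⊆-between p q k (drop-∷-⊆ p⊆q) lo hi
  = outside ∷ r , out⊆ p⊆r , s⊆s r⊆q , ∣r∣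
∃-⊆-between (inside ∷ p) (inside ∷ q) (suc k) p⊆q (s≤s lo) (s≤s hi)
  with r , p⊆r , r⊆q , ∣r∣ ← ∃-⊆-between p q k (drop-∷-⊆ p⊆q) lo hi
  = inside ∷ r , s⊆s p⊆r , s⊆s r⊆q , cong suc ∣r∣
∃-⊆-between (outside ∷ p) (inside ∷ q) k p⊆q lo hi with k ℕ.≤? ∣ q ∣
... | yes k≤∣q∣ with r , p⊆r , r⊆q , ∣r∣ ← ∃-⊆-between p q k (drop-∷-⊆ p⊆q) lo k≤∣q∣
  = outside ∷ r , s⊆s p⊆r , out⊆ r⊆q , ∣r∣
∃-⊆-between (outside ∷ p) (inside ∷ q) zero p⊆q lo hi | no k≰∣q∣ = contradiction z≤n k≰∣q∣
∃-⊆-between (outside ∷ p) (inside ∷ q) (suc k) p⊆q lo (s≤s hi) | no k≰∣q∣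
  with r , p⊆r , r⊆q , ∣r∣ ← ∃-⊆-between p q k (drop-∷-⊆ p⊆q)
         (ℕ.≤-trans (p⊆q⇒∣p∣≤∣q∣ (drop-∷-⊆ p⊆q)) (ℕ.≤-pred (ℕ.≰⇒> k≰∣q∣))) hi
  = inside ∷ r , out⊆ p⊆r , s⊆s r⊆q , cong suc ∣r∣

∃-⊆-ofSize : (q : Subset n) (k : ℕ) → k ≤ ∣ q ∣ → ∃ λ r → r ⊆ q × ∣ r ∣ ≡ k
∃-⊆-ofSize {n} q k k≤∣q∣
  with r , _ , r⊆q , ∣r∣ ← ∃-⊆-between ⊥ q k ⊥⊆ (ℕ.≤-trans (ℕ.≤-reflexive (∣⊥∣≡0 n)) z≤n) k≤∣q∣
  = r , r⊆q , ∣r∣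

∣p∪⁅x⁆∣≡1+∣p∣ : {p : Subset n} {x : Fin n} → x ∉ p → ∣ p ∪ ⁅ x ⁆ ∣ ≡ suc ∣ p ∣
∣p∪⁅x⁆∣≡1+∣p∣ {p = p} {x} x∉p = ℕ.≤-antisym
  (∣p∣≤1+∣q∣ {p = p ∪ ⁅ x ⁆} x λ y∈ y≢x →
    [ id , flip contradiction y≢x ∘ x∈⁅y⁆⇒x≡y x ]′ (x∈p∪q⁻ p ⁅ x ⁆ y∈))
  (ℕ.≤-trans (s≤s (p⊆q⇒∣p∣≤∣q∣ {q = p ∪ ⁅ x ⁆ - x} λ y∈p →
               x∈p∧x≢y⇒x∈p-y (x∈p∪q⁺ (inj₁ y∈p)) λ { refl → x∉p y∈p }))
             (x∈p⇒∣p-x∣<∣p∣ (x∈p∪q⁺ {p = p} (inj₂ (x∈⁅x⁆ x)))))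

2≤∣p∣⇒Fin : (S : Subset (suc m)) → 2 ≤ ∣ S ∣ → Fin m
2≤∣p∣⇒Fin {zero} S 2≤∣S∣ with s≤s () ← ℕ.≤-trans 2≤∣S∣ (∣p∣≤n S)
2≤∣p∣⇒Fin {suc m} _ _ = Fin.zero

module _ (G : Graph k) where

  ¬IsClique-nonedge : ∀ {S x y} → x ∈ S → y ∈ S → x ≢ y → adj G x y ≡ false → ¬ IsClique G S
  ¬IsClique-nonedge x∈ y∈ x≢y x≁y S-clique with () ← trans (sym (S-clique _ _ x∈ y∈ x≢y)) x≁y

  IsClique-≗ : ∀ (G′ : Graph k) {S} → (∀ u v → adj G u v ≡ adj G′ u v) → IsClique G S → IsClique G′ S
  IsClique-≗ G′ G≗G′ S-clique u v u∈ v∈ u≢v = trans (sym (G≗G′ u v)) (S-clique u v u∈ v∈ u≢v)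

  IsClique-⊆ : ∀ {S T} → T ⊆ S → IsClique G S → IsClique G T
  IsClique-⊆ T⊆S S-clique x y x∈ y∈ = S-clique x y (T⊆S x∈) (T⊆S y∈)

  IsIndep-⊆ : ∀ {S T} → T ⊆ S → IsIndep G S → IsIndep G T
  IsIndep-⊆ T⊆S S-indep x y x∈ y∈ = S-indep x y (T⊆S x∈) (T⊆S y∈)

  IsIndep-⁅x⁆ : (x : Fin k) → IsIndep G ⁅ x ⁆
  IsIndep-⁅x⁆ x y z y∈ z∈ rewrite x∈⁅y⁆⇒x≡y x y∈ | x∈⁅y⁆⇒x≡y x z∈ = irrefl G x

nonedge? : (G : Graph k) → (∃ λ a → ∃ λ b → a ≢ b × adj G a b ≡ false) ⊎ (∀ a b → a ≢ b → adj G a b ≡ true)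
nonedge? G with Fin.any? (λ a → Fin.any? (λ b → ¬? (a Fin.≟ b) ×-dec (adj G a b Data.Bool.Properties.≟ false)))
... | yes (a , b , a≢b , a≁b) = inj₁ (a , b , a≢b , a≁b)
... | no ¬nonedge = inj₂ complete
  where
  complete : ∀ a b → a ≢ b → adj G a b ≡ true
  complete a b a≢b with adj G a b in eq
  ... | true = refl
  ... | false = contradiction (a , b , a≢b , eq) ¬nonedge

cone? : (G : Graph k) → (∃ λ v → IsCone G v) ⊎ NoCone G
cone? G with Fin.any? (λ v → Fin.all? (λ w → ¬? (w Fin.≟ v) →-dec (adj G v w Data.Bool.Properties.≟ true)))
... | yes v-cone = inj₁ v-cone
... | no ¬cone = inj₂ λ v v-cone → ¬cone (v , v-cone)

Arrows⇒clique : ∀ {s a} (G : Graph k) {as : Vec ℕ s} → All (1 ≤_) as → Arrows G (a ∷ as) →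
  ∃ λ S → IsClique G S × ∣ S ∣ ≡ a
Arrows⇒clique G as≥1 G→ with G→ (λ _ → Fin.zero)
... | Fin.zero , S , S-clique , _ , ∣S∣ = S , S-clique , ∣S∣
... | Fin.suc i , S , _ , S-colour , ∣S∣ =
  contradiction (trans (sym ∣S∣) (Empty⇒∣p∣≡0 λ (x , x∈) → case S-colour x x∈ of λ ())) (ℕ.m<n⇒n≢0 (lookup⁺ as≥1 i))

arrows-mono : ∀ {s a a′} (G : Graph k) {as : Vec ℕ s} → a′ ≤ a → Arrows G (a ∷ as) → Arrows G (a′ ∷ as)
arrows-mono G a′≤a G→ c with G→ c
... | Fin.zero , S , S-clique , S-colour , ∣S∣ with T , T⊆S , ∣T∣ ← ∃-⊆-ofSize S _ (subst (_ ≤_) (sym ∣S∣) a′≤a) =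
  Fin.zero , T , IsClique-⊆ G T⊆S S-clique , (λ x x∈ → S-colour x (T⊆S x∈)) , ∣T∣
... | Fin.suc i , S , S-clique , S-colour , ∣S∣ = Fin.suc i , S , S-clique , S-colour , ∣S∣

AlphaGe-weaken : ∀ {r r′} (G : Graph k) → r ≤ r′ → AlphaGe G r′ → AlphaGe G r
AlphaGe-weaken G r≤r′ (S , S-indep , r′≤∣S∣) = S , S-indep , ℕ.≤-trans r≤r′ r′≤∣S∣

preimage : (Fin n → Fin m) → Subset m → Subset n
preimage f p = tabulate (λ x → lookup p (f x))

module _ {f : Fin n → Fin m} {p : Subset m} where

  ∈-preimage⁺ : {x : Fin n} → f x ∈ p → x ∈ preimage f p
  ∈-preimage⁺ fx∈p = ∈-tabulate⁺ (λ x → lookup p (f x)) (Vec.[]=⇒lookup fx∈p)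

  ∈-preimage⁻ : {x : Fin n} → x ∈ preimage f p → f x ∈ p
  ∈-preimage⁻ {x} x∈ = Vec.lookup⇒[]= (f x) p (∈-tabulate⁻ (λ x → lookup p (f x)) x∈)

module _ (f : Fin n ↔ Fin m) where
  open Inverse f

  to-injective : ∀ {x y} → to x ≡ to y → x ≡ y
  to-injective {x} {y} e = trans (sym (strictlyInverseʳ x)) (trans (cong from e) (strictlyInverseʳ y))

  from-injective : ∀ {x y} → from x ≡ from y → x ≡ y
  from-injective {x} {y} e = trans (sym (strictlyInverseˡ x)) (trans (cong to e) (strictlyInverseˡ y))

  ∣preimage∣≡∣p∣ : (p : Subset m) → ∣ preimage to p ∣ ≡ ∣ p ∣
  ∣preimage∣≡∣p∣ p = ℕ.≤-antisym
    (∣p∣≤∣q∣-injection to (preimage to p) p (λ _ _ → to-injective) ∈-preimage⁻)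
    (∣p∣≤∣q∣-injection from p (preimage to p) (λ _ _ → from-injective)
      (λ {x} x∈p → ∈-preimage⁺ (subst (_∈ p) (sym (strictlyInverseˡ x)) x∈p)))

  ↔⇒≡ : n ≡ m
  ↔⇒≡ = Fin.cantor-schröder-bernstein {f = to} {g = from} to-injective from-injective

Iso-refl : {G : Graph k} → Iso G G
Iso-refl = ↔-refl , λ _ _ → refl

Iso-sym : {G : Graph k} {G′ : Graph k′} → Iso G G′ → Iso G′ G
Iso-sym {G = G} {G′} (f , f-adj) = ↔-sym f , λ x y →
  trans (sym (f-adj (Inverse.from f x) (Inverse.from f y)))
    (cong₂ (adj G′) (Inverse.strictlyInverseˡ f x) (Inverse.strictlyInverseˡ f y))

⌊⌋-cong : {P Q : Set} (p : Dec P) (q : Dec Q) → (P → Q) → (Q → P) → ⌊ p ⌋ ≡ ⌊ q ⌋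
⌊⌋-cong (yes _) (yes _) _ _ = refl
⌊⌋-cong (yes p) (no ¬q) f g = contradiction (f p) ¬q
⌊⌋-cong (no ¬p) (yes q) f g = contradiction (g q) ¬p
⌊⌋-cong (no _) (no _) _ _ = refl

⌊⌋≡true : {A : Set} (a? : Dec A) → A → ⌊ a? ⌋ ≡ true
⌊⌋≡true a? a = trans (isYes≗does a?) (dec-true a? a)

pairB-injective : (g : Fin n → Fin m) → (∀ {u v} → g u ≡ g v → u ≡ v) →
  ∀ x y u v → pairB (g x) (g y) (g u) (g v) ≡ pairB x y u v
pairB-injective g inj x y u v =
  cong₂ _∨_ (cong₂ _∧_ (eq u x) (eq v y)) (cong₂ _∧_ (eq u y) (eq v x))
  where
  eq : ∀ a b → ⌊ g a Fin.≟ g b ⌋ ≡ ⌊ a Fin.≟ b ⌋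
  eq a b = ⌊⌋-cong (g a Fin.≟ g b) (a Fin.≟ b) inj (cong g)

addEdge-Iso : {G : Graph k} {G′ : Graph k′} (I : Iso G G′) {x y : Fin k} (x≢y : x ≢ y) →
  let open Inverse (proj₁ I) in
  (tx≢ty : to x ≢ to y) → Iso (addEdge G x y x≢y) (addEdge G′ (to x) (to y) tx≢ty)
addEdge-Iso (f , f-adj) {x} {y} _ _ = f , λ u v →
  cong₂ _∨_ (f-adj u v) (pairB-injective (Inverse.to f) (to-injective f) x y u v)

module _ (G : Graph k) (G′ : Graph k′) (I : Iso G G′) where
  open Inverse (proj₁ I)

  IsClique-preimage : ∀ {S} → IsClique G′ S → IsClique G (preimage to S)
  IsClique-preimage S-clique x y x∈ y∈ x≢y =
    trans (sym (proj₂ I x y)) (S-clique (to x) (to y) (∈-preimage⁻ x∈) (∈-preimage⁻ y∈) (x≢y ∘ to-injective (proj₁ I)))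

  IsIndep-preimage : ∀ {S} → IsIndep G′ S → IsIndep G (preimage to S)
  IsIndep-preimage S-indep x y x∈ y∈ = trans (sym (proj₂ I x y)) (S-indep (to x) (to y) (∈-preimage⁻ x∈) (∈-preimage⁻ y∈))

  IsCone-preimage : ∀ {w} → IsCone G′ w → IsCone G (from w)
  IsCone-preimage {w} w-cone x x≢w = begin
    adj G (from w) x           ≡⟨ cong (adj G (from w)) (sym (strictlyInverseʳ x)) ⟩
    adj G (from w) (from (to x)) ≡⟨ proj₂ (Iso-sym {G = G} {G′ = G′} I) w (to x) ⟩
    adj G′ w (to x)            ≡⟨ w-cone (to x) (λ e → x≢w (trans (sym (strictlyInverseʳ x)) (cong from e))) ⟩
    true                       ∎
    where open ≡-Reasoning

module Iso-invariance (G : Graph k) (G′ : Graph k′) (I : Iso G G′) where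
  open Inverse (proj₁ I)
  private
    I⁻¹ : Iso G′ G
    I⁻¹ = Iso-sym {G = G} {G′ = G′} I

  omegaLt : ∀ {q} → OmegaLt G q → OmegaLt G′ q
  omegaLt {q} ω<q S S-clique = subst (_< q) (∣preimage∣≡∣p∣ (proj₁ I) S) (ω<q _ (IsClique-preimage G G′ I S-clique))

  alphaLe : ∀ {t} → AlphaLe G t → AlphaLe G′ t
  alphaLe {t} α≤t S S-indep = subst (_≤ t) (∣preimage∣≡∣p∣ (proj₁ I) S) (α≤t _ (IsIndep-preimage G G′ I S-indep))

  alphaGe : ∀ {r} → AlphaGe G r → AlphaGe G′ r
  alphaGe {r} (S , S-indep , r≤∣S∣) =
    _ , IsIndep-preimage G′ G I⁻¹ S-indep , subst (r ≤_) (sym (∣preimage∣≡∣p∣ (proj₁ I⁻¹) S)) r≤∣S∣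

  arrows : ∀ {s} (as : Vec ℕ s) → Arrows G as → Arrows G′ as
  arrows as G→as c with i , S , S-clique , S-colour , ∣S∣ ← G→as (c ∘ to) =
    i , _ , IsClique-preimage G′ G I⁻¹ S-clique ,
    (λ y y∈ → trans (cong c (sym (strictlyInverseˡ y))) (S-colour (from y) (∈-preimage⁻ y∈))) ,
    trans (∣preimage∣≡∣p∣ (proj₁ I⁻¹) S) ∣S∣

  plusK : ∀ {q} → PlusK q G → PlusK q G′
  plusK G-plus x′ y′ x′≢y′ x′≁y′
    with S , S-clique , ∣S∣ , S-new ← G-plus (from x′) (from y′) (x′≢y′ ∘ from-injective (proj₁ I))
                                        (trans (proj₂ I⁻¹ x′ y′) x′≁y′) =
    S′ , S′-clique , trans (∣preimage∣≡∣p∣ (proj₁ I⁻¹) S) ∣S∣ , S-new ∘ old-clique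
    where
    x≢y : from x′ ≢ from y′
    x≢y = x′≢y′ ∘ from-injective (proj₁ I)
    S′ : Subset k′
    S′ = preimage from S
    S′-clique : IsClique (addEdge G′ x′ y′ x′≢y′) S′
    S′-clique = subst₂ (λ a b → ∀ a≢b → IsClique (addEdge G′ a b a≢b) S′) (strictlyInverseˡ x′) (strictlyInverseˡ y′)
      (λ tx≢ty → IsClique-preimage (addEdge G′ _ _ tx≢ty) (addEdge G _ _ x≢y)
        (Iso-sym {G = addEdge G _ _ x≢y} {G′ = addEdge G′ _ _ tx≢ty} (addEdge-Iso {G = G} {G′ = G′} I x≢y tx≢ty)) S-clique)
      x′≢y′
    S⊆ : S ⊆ preimage to S′
    S⊆ {a} a∈ = ∈-preimage⁺ {f = to} (∈-preimage⁺ {f = from} (subst (_∈ S) (sym (strictlyInverseʳ a)) a∈))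
    old-clique : IsClique G′ S′ → IsClique G S
    old-clique S′-clique a b a∈ b∈ = IsClique-preimage G G′ I S′-clique a b (S⊆ a∈) (S⊆ b∈)

  inH : ∀ {s} {as : Vec ℕ s} {q n} → InH as q n G → InH as q n G′
  inH {as = as} (k≡n , G→as , ω<q) = trans (sym (↔⇒≡ (proj₁ I))) k≡n , arrows as G→as , omegaLt ω<q

  inHPlusT : ∀ {s} {as : Vec ℕ s} {m q n t} → InHPlusT as m q n t G → InHPlusT as m q n t G′
  inHPlusT {as = as} (G∈H , G-plus , α≤t) = inH {as = as} G∈H , plusK G-plus , alphaLe α≤t

  noCone : NoCone G → NoCone G′
  noCone G-noCone w w-cone = G-noCone (from w) (IsCone-preimage G G′ I w-cone)

  exactlyOneCone : ExactlyOneCone G → ExactlyOneCone G′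
  exactlyOneCone (v , v-cone , v-unique) =
    to v , IsCone-preimage G′ G I⁻¹ v-cone ,
    λ w w-cone → trans (sym (strictlyInverseˡ w)) (cong to (v-unique (from w) (IsCone-preimage G G′ I w-cone)))

Endpoints : (x y u v : Fin k) → Set
Endpoints x y u v = (u ≡ x × v ≡ y) ⊎ (u ≡ y × v ≡ x)

¬Endpoints-u : {x y u v : Fin k} → u ≢ x → u ≢ y → ¬ Endpoints x y u v
¬Endpoints-u u≢x u≢y (inj₁ (u≡x , _)) = u≢x u≡x
¬Endpoints-u u≢x u≢y (inj₂ (u≡y , _)) = u≢y u≡y

¬Endpoints-v : {x y u v : Fin k} → v ≢ x → v ≢ y → ¬ Endpoints x y u v
¬Endpoints-v v≢x v≢y (inj₁ (_ , v≡y)) = v≢y v≡y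
¬Endpoints-v v≢x v≢y (inj₂ (_ , v≡x)) = v≢x v≡x

¬Endpoints-y : {x y u v : Fin k} → u ≢ y → v ≢ y → ¬ Endpoints x y u v
¬Endpoints-y u≢y v≢y (inj₁ (_ , v≡y)) = v≢y v≡y
¬Endpoints-y u≢y v≢y (inj₂ (u≡y , _)) = u≢y u≡y

∈pair⇒Endpoints : {x y u v : Fin k} → u ∈ pair x y → v ∈ pair x y → u ≢ v → Endpoints x y u v
∈pair⇒Endpoints u∈ v∈ u≢v with ∈pair⇒ u∈ | ∈pair⇒ v∈
... | inj₁ u≡x | inj₂ v≡y = inj₁ (u≡x , v≡y)
... | inj₂ u≡y | inj₁ v≡x = inj₂ (u≡y , v≡x)
... | inj₁ u≡x | inj₁ v≡x = contradiction (trans u≡x (sym v≡x)) u≢v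
... | inj₂ u≡y | inj₂ v≡y = contradiction (trans u≡y (sym v≡y)) u≢v

Endpoints-map : (f : Fin k → Fin m) {x y u v : Fin k} → Endpoints x y u v → Endpoints (f x) (f y) (f u) (f v)
Endpoints-map f (inj₁ (u≡x , v≡y)) = inj₁ (cong f u≡x , cong f v≡y)
Endpoints-map f (inj₂ (u≡y , v≡x)) = inj₂ (cong f u≡y , cong f v≡x)

pairB≡true⇒Endpoints : (x y u v : Fin k) → pairB x y u v ≡ true → Endpoints x y u v
pairB≡true⇒Endpoints x y u v h with u Fin.≟ x | v Fin.≟ y | u Fin.≟ y | v Fin.≟ x
... | yes u≡x | yes v≡y | _ | _ = inj₁ (u≡x , v≡y)
... | yes _ | no _ | yes u≡y | yes v≡x = inj₂ (u≡y , v≡x)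
... | no _ | _ | yes u≡y | yes v≡x = inj₂ (u≡y , v≡x)
pairB≡true⇒Endpoints x y u v () | yes _ | no _ | yes _ | no _
pairB≡true⇒Endpoints x y u v () | yes _ | no _ | no _ | _
pairB≡true⇒Endpoints x y u v () | no _ | _ | no _ | _
pairB≡true⇒Endpoints x y u v () | no _ | _ | yes _ | no _

pairB≡false : (x y u v : Fin k) → ¬ Endpoints x y u v → pairB x y u v ≡ false
pairB≡false x y u v ¬end with pairB x y u v in eq
... | false = refl
... | true = contradiction (pairB≡true⇒Endpoints x y u v eq) ¬end

Endpoints⇒pairB≡true : (x y u v : Fin k) → Endpoints x y u v → pairB x y u v ≡ true
Endpoints⇒pairB≡true x y u v (inj₁ (u≡x , v≡y)) =
  cong (_∨ (⌊ u Fin.≟ y ⌋ ∧ ⌊ v Fin.≟ x ⌋)) (cong₂ _∧_ (⌊⌋≡true (u Fin.≟ x) u≡x) (⌊⌋≡true (v Fin.≟ y) v≡y))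
Endpoints⇒pairB≡true x y u v (inj₂ (u≡y , v≡x)) = trans
  (cong ((⌊ u Fin.≟ x ⌋ ∧ ⌊ v Fin.≟ y ⌋) ∨_) (cong₂ _∧_ (⌊⌋≡true (u Fin.≟ y) u≡y) (⌊⌋≡true (v Fin.≟ x) v≡x)))
  (Data.Bool.Properties.∨-zeroʳ _)

module AddEdge (G : Graph k) (x y : Fin k) (x≢y : x ≢ y) where

  G⁺ : Graph k
  G⁺ = addEdge G x y x≢y

  adj⁺-old : ∀ {u v} → adj G u v ≡ true → adj G⁺ u v ≡ true
  adj⁺-old {u} {v} uv rewrite uv = refl

  adj⁺-endpoints : ∀ {u v} → Endpoints x y u v → adj G⁺ u v ≡ true
  adj⁺-endpoints {u} {v} end rewrite Endpoints⇒pairB≡true x y u v end = Data.Bool.Properties.∨-zeroʳ (adj G u v)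

  adj⁺-cases : ∀ {u v} → adj G⁺ u v ≡ true → adj G u v ≡ true ⊎ Endpoints x y u v
  adj⁺-cases {u} {v} uv with adj G u v
  ... | true = inj₁ refl
  ... | false = inj₂ (pairB≡true⇒Endpoints x y u v uv)

  adj⁺-other : ∀ {u v} → ¬ Endpoints x y u v → adj G⁺ u v ≡ adj G u v
  adj⁺-other {u} {v} ¬end rewrite pairB≡false x y u v ¬end = Data.Bool.Properties.∨-identityʳ (adj G u v)

  IsClique⁺-∌x : ∀ {S} → IsClique G⁺ S → x ∉ S → IsClique G S
  IsClique⁺-∌x S-clique x∉S u v u∈ v∈ u≢v with adj⁺-cases (S-clique u v u∈ v∈ u≢v)
  ... | inj₁ uv = uv
  ... | inj₂ (inj₁ (refl , _)) = contradiction u∈ x∉S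
  ... | inj₂ (inj₂ (_ , refl)) = contradiction v∈ x∉S

  IsClique⁺-∌y : ∀ {S} → IsClique G⁺ S → y ∉ S → IsClique G S
  IsClique⁺-∌y S-clique y∉S u v u∈ v∈ u≢v with adj⁺-cases (S-clique u v u∈ v∈ u≢v)
  ... | inj₁ uv = uv
  ... | inj₂ (inj₁ (_ , refl)) = contradiction v∈ y∉S
  ... | inj₂ (inj₂ (refl , _)) = contradiction u∈ y∉S

  new-clique-∋xy : ∀ {S} → IsClique G⁺ S → ¬ IsClique G S → x ∈ S × y ∈ S
  new-clique-∋xy {S} S-clique S-new with x ∈? S | y ∈? S
  ... | yes x∈ | yes y∈ = x∈ , y∈
  ... | no x∉ | _ = contradiction (IsClique⁺-∌x S-clique x∉) S-new
  ... | yes _ | no y∉ = contradiction (IsClique⁺-∌y S-clique y∉) S-new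

  IsClique⁺-x : ∀ {S} → IsClique G⁺ S → IsClique G (S - x)
  IsClique⁺-x {S} S-clique = IsClique⁺-∌x (IsClique-⊆ G⁺ (p─q⊆p S ⁅ x ⁆) S-clique) (x∉p-x S x)

  ω⁺≤ : ∀ {q} → OmegaLt G q → ∀ S → IsClique G⁺ S → ∣ S ∣ ≤ q
  ω⁺≤ ω<q S S-clique = ℕ.≤-trans (∣p∣≤1+∣p-x∣ S x) (ω<q (S - x) (IsClique⁺-x S-clique))

NewClique : ℕ → (G : Graph k) (x y : Fin k) → x ≢ y → Set
NewClique q G x y x≢y = ∃ λ S → IsClique (addEdge G x y x≢y) S × ∣ S ∣ ≡ q × ¬ IsClique G S

-- What remains of a new q-clique through the added edge xy once x is deleted.
NewClique∖x : ℕ → (G : Graph k) (x y : Fin k) → Set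
NewClique∖x q G x y = ∃ λ C → IsClique G C × y ∈ C × q ≤ suc ∣ C ∣ × (∀ {z} → z ∈ C → z ≢ y → adj G x z ≡ true)

module _ (G : Graph k) {q : ℕ} where

  PlusK⇒AllAddEdgeOmegaEq : PlusK q G → OmegaLt G q → AllAddEdgeOmegaEq G q
  PlusK⇒AllAddEdgeOmegaEq G-plus ω<q x y x≢y x≁y with S , S-clique , ∣S∣ , _ ← G-plus x y x≢y x≁y =
    (S , S-clique , ∣S∣) , AddEdge.ω⁺≤ G x y x≢y ω<q

  AllAddEdgeOmegaEq⇒PlusK : AllAddEdgeOmegaEq G q → OmegaLt G q → PlusK q G
  AllAddEdgeOmegaEq⇒PlusK all-ω≡q ω<q x y x≢y x≁y with (S , S-clique , ∣S∣) , _ ← all-ω≡q x y x≢y x≁y =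
    S , S-clique , ∣S∣ , λ S-clique′ → ℕ.<-irrefl ∣S∣ (ω<q S S-clique′)

  PlusK⇒NewClique∖x : PlusK q G → ∀ {x y} → x ≢ y → adj G x y ≡ false → NewClique∖x q G x y
  PlusK⇒NewClique∖x G-plus {x} {y} x≢y x≁y with S , S-clique , ∣S∣ , S-new ← G-plus x y x≢y x≁y
    with x∈ , y∈ ← AddEdge.new-clique-∋xy G x y x≢y S-clique S-new =
    S - x , AddEdge.IsClique⁺-x G x y x≢y S-clique , x∈p∧x≢y⇒x∈p-y y∈ (x≢y ∘ sym) ,
    ℕ.≤-trans (ℕ.≤-reflexive (sym ∣S∣)) (∣p∣≤1+∣p-x∣ S x) ,
    λ {z} z∈ z≢y → trans (sym (AddEdge.adj⁺-other G x y x≢y (¬Endpoints-y x≢y z≢y)))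
                         (S-clique x z x∈ (p─q⊆p S ⁅ x ⁆ z∈) (∈p-x⇒≢ {p = S} z∈ ∘ sym))

fromParts : (A : Subset k) → Fin ∣ A ∣ ⊎ Fin ∣ ∁ A ∣ → Fin k
fromParts (inside ∷ A) (inj₁ Fin.zero) = Fin.zero
fromParts (inside ∷ A) (inj₁ (Fin.suc i)) = Fin.suc (fromParts A (inj₁ i))
fromParts (inside ∷ A) (inj₂ j) = Fin.suc (fromParts A (inj₂ j))
fromParts (outside ∷ A) (inj₁ i) = Fin.suc (fromParts A (inj₁ i))
fromParts (outside ∷ A) (inj₂ Fin.zero) = Fin.zero
fromParts (outside ∷ A) (inj₂ (Fin.suc j)) = Fin.suc (fromParts A (inj₂ j))

toParts : (A : Subset k) → Fin k → Fin ∣ A ∣ ⊎ Fin ∣ ∁ A ∣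
toParts (inside ∷ A) Fin.zero = inj₁ Fin.zero
toParts (outside ∷ A) Fin.zero = inj₂ Fin.zero
toParts (inside ∷ A) (Fin.suc x) = Data.Sum.map₁ Fin.suc (toParts A x)
toParts (outside ∷ A) (Fin.suc x) = Data.Sum.map₂ Fin.suc (toParts A x)

fromParts∘toParts : (A : Subset k) (x : Fin k) → fromParts A (toParts A x) ≡ x
fromParts∘toParts (inside ∷ A) Fin.zero = refl
fromParts∘toParts (outside ∷ A) Fin.zero = refl
fromParts∘toParts (inside ∷ A) (Fin.suc x) with toParts A x | fromParts∘toParts A x
... | inj₁ _ | eq = cong Fin.suc eq
... | inj₂ _ | eq = cong Fin.suc eq
fromParts∘toParts (outside ∷ A) (Fin.suc x) with toParts A x | fromParts∘toParts A x
... | inj₁ _ | eq = cong Fin.suc eq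
... | inj₂ _ | eq = cong Fin.suc eq

toParts∘fromParts : (A : Subset k) (u : Fin ∣ A ∣ ⊎ Fin ∣ ∁ A ∣) → toParts A (fromParts A u) ≡ u
toParts∘fromParts (inside ∷ A) (inj₁ Fin.zero) = refl
toParts∘fromParts (inside ∷ A) (inj₁ (Fin.suc i)) rewrite toParts∘fromParts A (inj₁ i) = refl
toParts∘fromParts (inside ∷ A) (inj₂ j) rewrite toParts∘fromParts A (inj₂ j) = refl
toParts∘fromParts (outside ∷ A) (inj₁ i) rewrite toParts∘fromParts A (inj₁ i) = refl
toParts∘fromParts (outside ∷ A) (inj₂ Fin.zero) = refl
toParts∘fromParts (outside ∷ A) (inj₂ (Fin.suc j)) rewrite toParts∘fromParts A (inj₂ j) = refl

fromParts-inside : (A : Subset k) (i : Fin ∣ A ∣) → fromParts A (inj₁ i) ∈ A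
fromParts-inside (inside ∷ A) Fin.zero = here
fromParts-inside (inside ∷ A) (Fin.suc i) = there (fromParts-inside A i)
fromParts-inside (outside ∷ A) i = there (fromParts-inside A i)

fromParts-outside : (A : Subset k) (j : Fin ∣ ∁ A ∣) → fromParts A (inj₂ j) ∉ A
fromParts-outside (inside ∷ A) j (there x∈) = fromParts-outside A j x∈
fromParts-outside (outside ∷ A) (Fin.suc j) (there x∈) = fromParts-outside A j x∈

x∉A⇒fromParts : (A : Subset k) {x : Fin k} → x ∉ A → ∃ λ j → x ≡ fromParts A (inj₂ j)
x∉A⇒fromParts A {x} x∉A with toParts A x | fromParts∘toParts A x
... | inj₁ i | refl = contradiction (fromParts-inside A i) x∉A
... | inj₂ j | eq = j , sym eq

parts↔ : (A : Subset k) → (Fin ∣ A ∣ ⊎ Fin ∣ ∁ A ∣) ↔ Fin k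
parts↔ A = mk↔ₛ′ (fromParts A) (toParts A) (fromParts∘toParts A) (toParts∘fromParts A)

_∖_ : Graph k → (A : Subset k) → Graph ∣ ∁ A ∣
G ∖ A = record
  { adj = λ i j → adj G (fromParts A (inj₂ i)) (fromParts A (inj₂ j))
  ; adj-sym = λ i j → Graph.adj-sym G _ _
  ; irrefl = λ i → irrefl G _
  }

join-decomposition : (G : Graph k) (B : Subset k) → IsIndep G B →
  (∀ b x → b ∈ B → x ∉ B → adj G b x ≡ true) → ∀ p → ∣ B ∣ ≡ p →
  Iso (join (empty p) (G ∖ B)) G
join-decomposition G B B-indep B-full _ refl =
  ↔-trans Fin.+↔⊎ (parts↔ B) , λ x y → adj≡ (splitAt ∣ B ∣ x) (splitAt ∣ B ∣ y)
  where
  adj≡ : ∀ u v → adj G (fromParts B u) (fromParts B v) ≡ joinAdj (λ _ _ → false) (adj (G ∖ B)) u v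
  adj≡ (inj₁ i) (inj₁ j) = B-indep _ _ (fromParts-inside B i) (fromParts-inside B j)
  adj≡ (inj₁ i) (inj₂ j) = B-full _ _ (fromParts-inside B i) (fromParts-outside B j)
  adj≡ (inj₂ i) (inj₁ j) = trans (Graph.adj-sym G _ _) (B-full _ _ (fromParts-inside B j) (fromParts-outside B i))
  adj≡ (inj₂ i) (inj₂ j) = refl

extension-decomposition : (G : Graph k) (A : Subset k) → IsIndep G A → ∀ r → ∣ A ∣ ≡ r →
  Σ (Fin r → Subset ∣ ∁ A ∣) λ Ms → Iso (extend (G ∖ A) Ms) G
extension-decomposition G A A-indep _ refl =
  neighbourhood , ↔-trans Fin.+↔⊎ (↔-trans swap-↔ (parts↔ A)) ,
  λ x y → adj≡ (splitAt ∣ ∁ A ∣ x) (splitAt ∣ ∁ A ∣ y)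
  where
  neighbourhood : Fin ∣ A ∣ → Subset ∣ ∁ A ∣
  neighbourhood j = tabulate λ i → adj G (fromParts A (inj₂ i)) (fromParts A (inj₁ j))
  adj≡ : ∀ u v → adj G (fromParts A (swap u)) (fromParts A (swap v)) ≡ extAdj (G ∖ A) neighbourhood u v
  adj≡ (inj₁ i) (inj₁ j) = refl
  adj≡ (inj₁ i) (inj₂ j) = sym (Vec.lookup∘tabulate _ i)
  adj≡ (inj₂ i) (inj₁ j) = trans (Graph.adj-sym G _ _) (sym (Vec.lookup∘tabulate _ j))
  adj≡ (inj₂ i) (inj₂ j) = A-indep _ _ (fromParts-inside A i) (fromParts-inside A j)

data SplitView (p m : ℕ) : Fin (p + m) → Set where
  left  : (i : Fin p) → SplitView p m (i ↑ˡ m)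
  right : (j : Fin m) → SplitView p m (p ↑ʳ j)

splitView : ∀ p m (x : Fin (p + m)) → SplitView p m x
splitView p m x with splitAt p x in eq
... | inj₁ i rewrite sym (Fin.splitAt⁻¹-↑ˡ eq) = left i
... | inj₂ j rewrite sym (Fin.splitAt⁻¹-↑ʳ eq) = right j

↑ˡ≢↑ʳ : {i : Fin p} {j : Fin m} → i ↑ˡ m ≢ p ↑ʳ j
↑ˡ≢↑ʳ {p} {m} {i} {j} e with () ← trans (sym (Fin.splitAt-↑ˡ p i m)) (trans (cong (splitAt p) e) (Fin.splitAt-↑ʳ p m j))

leftPart : ∀ p {m} → Subset (p + m) → Subset p
leftPart p {m} = preimage (_↑ˡ m)

rightPart : ∀ p {m} → Subset (p + m) → Subset m
rightPart p = preimage (p ↑ʳ_)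

∣S∣≡∣left∣+∣right∣ : ∀ p {m} (S : Subset (p + m)) → ∣ S ∣ ≡ ∣ leftPart p S ∣ + ∣ rightPart p S ∣
∣S∣≡∣left∣+∣right∣ zero S = cong ∣_∣ (sym (Vec.tabulate∘lookup S))
∣S∣≡∣left∣+∣right∣ (suc p) (inside ∷ S) = cong suc (∣S∣≡∣left∣+∣right∣ p S)
∣S∣≡∣left∣+∣right∣ (suc p) (outside ∷ S) = ∣S∣≡∣left∣+∣right∣ p S

∣p++q∣≡∣p∣+∣q∣ : (S : Subset p) (T : Subset m) → ∣ S ++ T ∣ ≡ ∣ S ∣ + ∣ T ∣
∣p++q∣≡∣p∣+∣q∣ [] T = refl
∣p++q∣≡∣p∣+∣q∣ (inside ∷ S) T = cong suc (∣p++q∣≡∣p∣+∣q∣ S T)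
∣p++q∣≡∣p∣+∣q∣ (outside ∷ S) T = ∣p++q∣≡∣p∣+∣q∣ S T

∣p++⊥∣≡∣p∣ : (S : Subset p) → ∣ S ++ ⊥ {m} ∣ ≡ ∣ S ∣
∣p++⊥∣≡∣p∣ {m = m} S = trans (∣p++q∣≡∣p∣+∣q∣ S (⊥ {m})) (trans (cong (∣ S ∣ +_) (∣⊥∣≡0 m)) (ℕ.+-identityʳ _))

∣⊥++q∣≡∣q∣ : (T : Subset m) → ∣ ⊥ {p} ++ T ∣ ≡ ∣ T ∣
∣⊥++q∣≡∣q∣ {p = p} T = trans (∣p++q∣≡∣p∣+∣q∣ (⊥ {p}) T) (cong (_+ ∣ T ∣) (∣⊥∣≡0 p))

module _ {S : Subset p} {T : Subset m} where

  ∈-++⁺ˡ : ∀ {i} → i ∈ S → (i ↑ˡ m) ∈ S ++ T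
  ∈-++⁺ˡ {i} i∈ = Vec.lookup⇒[]= _ (S ++ T) (trans (Vec.lookup-++ˡ S T i) (Vec.[]=⇒lookup i∈))

  ∈-++⁺ʳ : ∀ {j} → j ∈ T → (p ↑ʳ j) ∈ S ++ T
  ∈-++⁺ʳ {j} j∈ = Vec.lookup⇒[]= _ (S ++ T) (trans (Vec.lookup-++ʳ S T j) (Vec.[]=⇒lookup j∈))

  ∈-++⁻ˡ : ∀ {i} → (i ↑ˡ m) ∈ S ++ T → i ∈ S
  ∈-++⁻ˡ {i} i∈ = Vec.lookup⇒[]= i S (trans (sym (Vec.lookup-++ˡ S T i)) (Vec.[]=⇒lookup i∈))

  ∈-++⁻ʳ : ∀ {j} → (p ↑ʳ j) ∈ S ++ T → j ∈ T
  ∈-++⁻ʳ {j} j∈ = Vec.lookup⇒[]= j T (trans (sym (Vec.lookup-++ʳ S T j)) (Vec.[]=⇒lookup j∈))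

module _ {G : Graph p} {H : Graph m} where

  adj-join-ll : ∀ i i′ → adj (join G H) (i ↑ˡ m) (i′ ↑ˡ m) ≡ adj G i i′
  adj-join-ll i i′ rewrite Fin.splitAt-↑ˡ p i m | Fin.splitAt-↑ˡ p i′ m = refl

  adj-join-lr : ∀ i j → adj (join G H) (i ↑ˡ m) (p ↑ʳ j) ≡ true
  adj-join-lr i j rewrite Fin.splitAt-↑ˡ p i m | Fin.splitAt-↑ʳ p m j = refl

  adj-join-rl : ∀ j i → adj (join G H) (p ↑ʳ j) (i ↑ˡ m) ≡ true
  adj-join-rl j i rewrite Fin.splitAt-↑ˡ p i m | Fin.splitAt-↑ʳ p m j = refl

  adj-join-rr : ∀ j j′ → adj (join G H) (p ↑ʳ j) (p ↑ʳ j′) ≡ adj H j j′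
  adj-join-rr j j′ rewrite Fin.splitAt-↑ʳ p m j | Fin.splitAt-↑ʳ p m j′ = refl

module _ {H : Graph p} {Ms : Fin m → Subset p} where

  adj-extend-ll : ∀ i i′ → adj (extend H Ms) (i ↑ˡ m) (i′ ↑ˡ m) ≡ adj H i i′
  adj-extend-ll i i′ rewrite Fin.splitAt-↑ˡ p i m | Fin.splitAt-↑ˡ p i′ m = refl

  adj-extend-lr : ∀ i j → adj (extend H Ms) (i ↑ˡ m) (p ↑ʳ j) ≡ lookup (Ms j) i
  adj-extend-lr i j rewrite Fin.splitAt-↑ˡ p i m | Fin.splitAt-↑ʳ p m j = refl

  adj-extend-rl : ∀ j i → adj (extend H Ms) (p ↑ʳ j) (i ↑ˡ m) ≡ lookup (Ms j) i
  adj-extend-rl j i rewrite Fin.splitAt-↑ˡ p i m | Fin.splitAt-↑ʳ p m j = refl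

  adj-extend-rr : ∀ j j′ → adj (extend H Ms) (p ↑ʳ j) (p ↑ʳ j′) ≡ false
  adj-extend-rr j j′ rewrite Fin.splitAt-↑ʳ p m j | Fin.splitAt-↑ʳ p m j′ = refl

addEdge-join-≗ : (G : Graph p) (H : Graph m) {i j : Fin m} (i≢j : i ≢ j) (pi≢pj : p ↑ʳ i ≢ p ↑ʳ j)
  (u v : Fin (p + m)) → adj (addEdge (join G H) (p ↑ʳ i) (p ↑ʳ j) pi≢pj) u v ≡ adj (join G (addEdge H i j i≢j)) u v
addEdge-join-≗ {p} {m} G H {i} {j} i≢j pi≢pj u v with splitView p m u | splitView p m v
... | left a | left b = trans (AddEdge.adj⁺-other (join G H) _ _ pi≢pj (¬Endpoints-u ↑ˡ≢↑ʳ ↑ˡ≢↑ʳ))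
  (trans (adj-join-ll {G = G} {H = H} a b) (sym (adj-join-ll {G = G} {H = addEdge H i j i≢j} a b)))
... | left a | right b = trans (AddEdge.adj⁺-old (join G H) _ _ pi≢pj (adj-join-lr {G = G} {H = H} a b))
  (sym (adj-join-lr {G = G} {H = addEdge H i j i≢j} a b))
... | right a | left b = trans (AddEdge.adj⁺-old (join G H) _ _ pi≢pj (adj-join-rl {G = G} {H = H} a b))
  (sym (adj-join-rl {G = G} {H = addEdge H i j i≢j} a b))
... | right a | right b = trans
  (cong₂ _∨_ (adj-join-rr {G = G} {H = H} a b) (pairB-injective (p ↑ʳ_) (Fin.↑ʳ-injective p _ _) i j a b))
  (sym (adj-join-rr {G = G} {H = addEdge H i j i≢j} a b))

module _ (G : Graph p) (H : Graph m) {i j : Fin m} (i≢j : i ≢ j) (pi≢pj : p ↑ʳ i ≢ p ↑ʳ j) {S : Subset (p + m)} where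

  IsClique-addEdge-join⁻ : IsClique (addEdge (join G H) (p ↑ʳ i) (p ↑ʳ j) pi≢pj) S → IsClique (join G (addEdge H i j i≢j)) S
  IsClique-addEdge-join⁻ = IsClique-≗ (addEdge (join G H) _ _ pi≢pj) (join G (addEdge H i j i≢j)) (addEdge-join-≗ G H i≢j pi≢pj)

  IsClique-addEdge-join⁺ : IsClique (join G (addEdge H i j i≢j)) S → IsClique (addEdge (join G H) (p ↑ʳ i) (p ↑ʳ j) pi≢pj) S
  IsClique-addEdge-join⁺ = IsClique-≗ (join G (addEdge H i j i≢j)) (addEdge (join G H) _ _ pi≢pj)
    (λ u v → sym (addEdge-join-≗ G H i≢j pi≢pj u v))

addEdge-extend-≗ : (H : Graph p) (Ms : Fin m → Subset p) {i j : Fin p} (i≢j : i ≢ j) (ii≢jj : i ↑ˡ m ≢ j ↑ˡ m)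
  (u v : Fin (p + m)) → adj (addEdge (extend H Ms) (i ↑ˡ m) (j ↑ˡ m) ii≢jj) u v ≡ adj (extend (addEdge H i j i≢j) Ms) u v
addEdge-extend-≗ {p} {m} H Ms {i} {j} i≢j ii≢jj u v with splitView p m u | splitView p m v
... | left a | left b = trans
  (cong₂ _∨_ (adj-extend-ll {H = H} {Ms = Ms} a b) (pairB-injective (_↑ˡ m) (Fin.↑ˡ-injective m _ _) i j a b))
  (sym (adj-extend-ll {H = addEdge H i j i≢j} {Ms = Ms} a b))
... | left a | right b = trans (AddEdge.adj⁺-other (extend H Ms) _ _ ii≢jj (¬Endpoints-v (↑ˡ≢↑ʳ ∘ sym) (↑ˡ≢↑ʳ ∘ sym)))
  (trans (adj-extend-lr {H = H} {Ms = Ms} a b) (sym (adj-extend-lr {H = addEdge H i j i≢j} {Ms = Ms} a b)))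
... | right a | left b = trans (AddEdge.adj⁺-other (extend H Ms) _ _ ii≢jj (¬Endpoints-u (↑ˡ≢↑ʳ ∘ sym) (↑ˡ≢↑ʳ ∘ sym)))
  (trans (adj-extend-rl {H = H} {Ms = Ms} a b) (sym (adj-extend-rl {H = addEdge H i j i≢j} {Ms = Ms} a b)))
... | right a | right b = trans (AddEdge.adj⁺-other (extend H Ms) _ _ ii≢jj (¬Endpoints-u (↑ˡ≢↑ʳ ∘ sym) (↑ˡ≢↑ʳ ∘ sym)))
  (trans (adj-extend-rr {H = H} {Ms = Ms} a b) (sym (adj-extend-rr {H = addEdge H i j i≢j} {Ms = Ms} a b)))

-- The cone K₁ + H

module ConeClique (H : Graph m) where
  private
    K : Graph (suc m)
    K = join K1 H

  IsClique⁺ : ∀ b {S} → IsClique H S → IsClique K (b ∷ S)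
  IsClique⁺ b S-clique Fin.zero Fin.zero _ _ 0≢0 = contradiction refl 0≢0
  IsClique⁺ b S-clique Fin.zero (Fin.suc y) _ _ _ = refl
  IsClique⁺ b S-clique (Fin.suc x) Fin.zero _ _ _ = refl
  IsClique⁺ b S-clique (Fin.suc x) (Fin.suc y) (there x∈) (there y∈) x≢y =
    S-clique x y x∈ y∈ (x≢y ∘ cong Fin.suc)

  IsClique⁻ : ∀ {b S} → IsClique K (b ∷ S) → IsClique H S
  IsClique⁻ S-clique x y x∈ y∈ x≢y = S-clique (Fin.suc x) (Fin.suc y) (there x∈) (there y∈) (x≢y ∘ Fin.suc-injective)

module Cone (H : Graph m) where
  open ConeClique H public

  K : Graph (suc m)
  K = join K1 H

  zero-isCone : IsCone K Fin.zero
  zero-isCone Fin.zero 0≢0 = contradiction refl 0≢0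
  zero-isCone (Fin.suc j) _ = refl

  IsIndep⁺ : ∀ {S} → IsIndep H S → IsIndep K (outside ∷ S)
  IsIndep⁺ S-indep (Fin.suc x) (Fin.suc y) (there x∈) (there y∈) = S-indep x y x∈ y∈

  IsIndep⁻ : ∀ {b S} → IsIndep K (b ∷ S) → IsIndep H S
  IsIndep⁻ S-indep x y x∈ y∈ = S-indep (Fin.suc x) (Fin.suc y) (there x∈) (there y∈)

  IsIndep-∋cone : ∀ {S} → IsIndep K (inside ∷ S) → Empty S
  IsIndep-∋cone S-indep (x , x∈) with () ← S-indep Fin.zero (Fin.suc x) here (there x∈)

  nonedge : ∀ {u v} → u ≢ v → adj K u v ≡ false →
    ∃ λ i → ∃ λ j → u ≡ Fin.suc i × v ≡ Fin.suc j × adj H i j ≡ false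
  nonedge {Fin.zero} {Fin.zero} 0≢0 _ = contradiction refl 0≢0
  nonedge {Fin.suc i} {Fin.suc j} _ i≁j = i , j , refl , refl , i≁j

  ω⁺ : ∀ {q} → OmegaLt H q → OmegaLt K (suc q)
  ω⁺ ω<q (b ∷ S) S-clique = ℕ.≤-trans (s≤s (∣x∷p∣≤1+∣p∣ b S)) (s≤s (ω<q S (IsClique⁻ S-clique)))

  ω⁻ : ∀ {q} → OmegaLt K (suc q) → OmegaLt H q
  ω⁻ ω<q S S-clique = ℕ.≤-pred (ω<q (inside ∷ S) (IsClique⁺ inside S-clique))

  α⁺ : ∀ {t} → 1 ≤ t → AlphaLe H t → AlphaLe K t
  α⁺ {t} 1≤t α≤t (inside ∷ S) S-indep = subst (_≤ t) (sym (cong suc (Empty⇒∣p∣≡0 (IsIndep-∋cone S-indep)))) 1≤t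
  α⁺ 1≤t α≤t (outside ∷ S) S-indep = α≤t S (IsIndep⁻ S-indep)

  α⁻ : ∀ {t} → AlphaLe K t → AlphaLe H t
  α⁻ α≤t S S-indep = α≤t (outside ∷ S) (IsIndep⁺ S-indep)

  αGe⁺ : ∀ {r} → AlphaGe H r → AlphaGe K r
  αGe⁺ (S , S-indep , r≤∣S∣) = outside ∷ S , IsIndep⁺ S-indep , r≤∣S∣

  αGe⁻ : ∀ {r} → Fin m → AlphaGe K r → AlphaGe H r
  αGe⁻ x (outside ∷ S , S-indep , r≤∣S∣) = S , IsIndep⁻ S-indep , r≤∣S∣
  αGe⁻ {r} x (inside ∷ S , S-indep , r≤∣S∣) = ⁅ x ⁆ , IsIndep-⁅x⁆ H x , (begin
    r               ≤⟨ r≤∣S∣ ⟩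
    suc ∣ S ∣        ≡⟨ cong suc (Empty⇒∣p∣≡0 (IsIndep-∋cone S-indep)) ⟩
    1               ≡⟨ sym (∣⁅x⁆∣≡1 x) ⟩
    ∣ ⁅ x ⁆ ∣        ∎)
    where open ℕ.≤-Reasoning

  PlusK⁺ : ∀ {q} → PlusK q H → PlusK (suc q) K
  PlusK⁺ H-plus u v u≢v u≁v with i , j , refl , refl , i≁j ← nonedge u≢v u≁v
    with S , S-clique , ∣S∣ , S-new ← H-plus i j (u≢v ∘ cong Fin.suc) i≁j =
    inside ∷ S ,
    IsClique-addEdge-join⁺ K1 H (u≢v ∘ cong Fin.suc) u≢v (ConeClique.IsClique⁺ (addEdge H i j (u≢v ∘ cong Fin.suc)) inside S-clique) ,
    cong suc ∣S∣ , S-new ∘ IsClique⁻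

  PlusK⁻ : ∀ {q} → OmegaLt H q → PlusK (suc q) K → PlusK q H
  PlusK⁻ {q} ω<q K-plus i j i≢j i≁j = drop-cone (K-plus (Fin.suc i) (Fin.suc j) si≢sj i≁j)
    where
    si≢sj : Fin.suc i ≢ Fin.suc j
    si≢sj = i≢j ∘ Fin.suc-injective
    drop-cone : NewClique (suc q) K _ _ si≢sj → NewClique q H i j i≢j
    drop-cone (b ∷ S , S-clique , ∣S∣ , S-new)
      with S-clique⁺ ← ConeClique.IsClique⁻ (addEdge H i j i≢j) (IsClique-addEdge-join⁻ K1 H i≢j si≢sj S-clique) with b
    ... | inside = S , S-clique⁺ , ℕ.suc-injective ∣S∣ , S-new ∘ IsClique⁺ inside
    ... | outside = contradiction (AddEdge.ω⁺≤ H i j i≢j ω<q S S-clique⁺) (ℕ.<⇒≱ (ℕ.≤-reflexive (sym ∣S∣)))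

  arrows⁻ : ∀ {a s} {as : Vec ℕ s} → Arrows K (a ∷ as) → Arrows H ((a ∸ 1) ∷ as)
  arrows⁻ {a} K→ c with K→ (λ { Fin.zero → Fin.zero ; (Fin.suc x) → c x })
  ... | Fin.zero , b ∷ S , S-clique , S-colour , ∣S∣
    with T , T⊆S , ∣T∣ ← ∃-⊆-ofSize S (a ∸ 1) (ℕ.∸-monoˡ-≤ 1 (subst (_≤ suc ∣ S ∣) ∣S∣ (∣x∷p∣≤1+∣p∣ b S)))
    = Fin.zero , T , IsClique-⊆ H T⊆S (IsClique⁻ S-clique) , (λ x x∈ → S-colour (Fin.suc x) (there (T⊆S x∈))) , ∣T∣
  ... | Fin.suc i , outside ∷ S , S-clique , S-colour , ∣S∣ =
    Fin.suc i , S , IsClique⁻ S-clique , (λ x x∈ → S-colour (Fin.suc x) (there x∈)) , ∣S∣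
  ... | Fin.suc i , inside ∷ S , _ , S-colour , _ with () ← S-colour Fin.zero here

  -- If H were complete, any vertex of H would be a second cone vertex; otherwise a new q-clique through a non-edge ab
  -- of H, minus the cone vertex and a, is a K_{q−2} in H.
  ∃K[q∸2] : ∀ {q} → PlusK q K → ExactlyOneCone K → Fin m → ∃ λ Q → IsClique H Q × ∣ Q ∣ ≡ q ∸ 2
  ∃K[q∸2] {q} K-plus (c , _ , c-unique) x with nonedge? H
  ... | inj₂ H-complete = contradiction (trans (c-unique Fin.zero zero-isCone) (sym (c-unique (Fin.suc x) x-cone))) λ ()
    where
    x-cone : IsCone K (Fin.suc x)
    x-cone Fin.zero _ = refl
    x-cone (Fin.suc y) y≢x = H-complete x y (y≢x ∘ cong Fin.suc ∘ sym)
  ... | inj₁ (a , b , a≢b , a≁b)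
    with bit ∷ S , S-clique , ∣S∣ , _ ← K-plus (Fin.suc a) (Fin.suc b) (a≢b ∘ Fin.suc-injective) a≁b
    with Q , Q⊆ , ∣Q∣ ← ∃-⊆-ofSize (S - a) (q ∸ 2) (ℕ.∸-monoˡ-≤ 2
      (ℕ.≤-trans (ℕ.≤-reflexive (sym ∣S∣)) (ℕ.≤-trans (∣x∷p∣≤1+∣p∣ bit S) (s≤s (∣p∣≤1+∣p-x∣ S a)))))
    = Q , IsClique-⊆ H Q⊆ (AddEdge.IsClique⁺-x H a b a≢b
          (ConeClique.IsClique⁻ (addEdge H a b a≢b) (IsClique-addEdge-join⁻ K1 H a≢b (a≢b ∘ Fin.suc-injective) S-clique))) ,
      ∣Q∣

-- Blowing up the cone: K̄ᵣ₊₁ + H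

occupied : Subset k → Side
occupied X with nonempty? X
... | yes _ = inside
... | no _ = outside

module BlowUpClique (r : ℕ) (H : Graph m) where
  private
    r⁺ : ℕ
    r⁺ = suc r

  J : Graph (r⁺ + m)
  J = join (empty r⁺) H

  K : Graph (suc m)
  K = join K1 H

  J-ll : ∀ i i′ → adj J (i ↑ˡ m) (i′ ↑ˡ m) ≡ false
  J-ll = adj-join-ll {G = empty r⁺} {H = H}

  J-lr : ∀ i j → adj J (i ↑ˡ m) (r⁺ ↑ʳ j) ≡ true
  J-lr = adj-join-lr {G = empty r⁺} {H = H}

  J-rl : ∀ j i → adj J (r⁺ ↑ʳ j) (i ↑ˡ m) ≡ true
  J-rl = adj-join-rl {G = empty r⁺} {H = H}

  J-rr : ∀ j j′ → adj J (r⁺ ↑ʳ j) (r⁺ ↑ʳ j′) ≡ adj H j j′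
  J-rr = adj-join-rr {G = empty r⁺} {H = H}

  expand : Subset (suc m) → Subset (r⁺ + m)
  expand (b ∷ S) = (b ∷ ⊥) ++ S

  ∣expand∣ : ∀ S → ∣ expand S ∣ ≡ ∣ S ∣
  ∣expand∣ (inside ∷ S) = trans (∣p++q∣≡∣p∣+∣q∣ (inside ∷ ⊥ {r}) S) (cong (λ z → suc z + ∣ S ∣) (∣⊥∣≡0 r))
  ∣expand∣ (outside ∷ S) = trans (∣p++q∣≡∣p∣+∣q∣ (outside ∷ ⊥ {r}) S) (cong (_+ ∣ S ∣) (∣⊥∣≡0 r))

  ∈-expand-left : ∀ {b S i} → (i ↑ˡ m) ∈ expand (b ∷ S) → i ≡ Fin.zero × b ≡ inside
  ∈-expand-left {b} {S} {i} i∈ with ∈-++⁻ˡ {S = b ∷ ⊥} {T = S} i∈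
  ... | here = refl , refl
  ... | there i∈⊥ = contradiction i∈⊥ ∉⊥

  ∈-expand-right : ∀ {b S j} → (r⁺ ↑ʳ j) ∈ expand (b ∷ S) → j ∈ S
  ∈-expand-right {b} = ∈-++⁻ʳ {S = b ∷ ⊥}

  ∋-expand-right : ∀ {b S j} → Fin.suc j ∈ b ∷ S → (r⁺ ↑ʳ j) ∈ expand (b ∷ S)
  ∋-expand-right {b} (there j∈) = ∈-++⁺ʳ {S = b ∷ ⊥} j∈

  IsClique-expand : ∀ {S} → IsClique K S → IsClique J (expand S)
  IsClique-expand {b ∷ S} S-clique x y x∈ y∈ x≢y with splitView r⁺ m x | splitView r⁺ m y
  ... | left i | left i′ with refl , _ ← ∈-expand-left {b} {S} x∈ | refl , _ ← ∈-expand-left {b} {S} y∈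
    = contradiction refl x≢y
  ... | left i | right j = J-lr i j
  ... | right j | left i = J-rl j i
  ... | right j | right j′ = trans (J-rr j j′)
    (S-clique (Fin.suc j) (Fin.suc j′) (there (∈-expand-right {b} x∈)) (there (∈-expand-right {b} y∈))
      (x≢y ∘ cong (r⁺ ↑ʳ_) ∘ Fin.suc-injective))

  collapse : Subset (r⁺ + m) → Subset (suc m)
  collapse S = occupied (leftPart r⁺ S) ∷ rightPart r⁺ S

  ∣left∣≤1 : ∀ {S} → IsClique J S → ∣ leftPart r⁺ S ∣ ≤ 1
  ∣left∣≤1 S-clique = ∣p∣≤1 λ {i} {i′} i∈ i′∈ → decidable-stable (i Fin.≟ i′) λ i≢i′ →
    ¬IsClique-nonedge J (∈-preimage⁻ {f = _↑ˡ m} i∈) (∈-preimage⁻ {f = _↑ˡ m} i′∈) (i≢i′ ∘ Fin.↑ˡ-injective m i i′)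
      (J-ll i i′) S-clique

  ∣collapse∣ : ∀ S → ∣ leftPart r⁺ S ∣ ≤ 1 → ∣ collapse S ∣ ≡ ∣ S ∣
  ∣collapse∣ S ∣left∣≤1′ with nonempty? (leftPart r⁺ S)
  ... | yes (i , i∈) = sym (trans (∣S∣≡∣left∣+∣right∣ r⁺ S) (cong (_+ ∣ rightPart r⁺ S ∣) ∣left∣≡1))
    where
    ∣left∣≡1 : ∣ leftPart r⁺ S ∣ ≡ 1
    ∣left∣≡1 = ℕ.≤-antisym ∣left∣≤1′ (ℕ.≤-trans (ℕ.≤-reflexive (sym (∣⁅x⁆∣≡1 i)))
                 (p⊆q⇒∣p∣≤∣q∣ λ i′∈ → subst (_∈ leftPart r⁺ S) (sym (x∈⁅y⁆⇒x≡y i i′∈)) i∈))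
  ... | no ¬ne = sym (trans (∣S∣≡∣left∣+∣right∣ r⁺ S) (cong (_+ ∣ rightPart r⁺ S ∣) (Empty⇒∣p∣≡0 ¬ne)))

  ∈-collapse-zero : ∀ {S} → Fin.zero ∈ collapse S → ∃ λ i → (i ↑ˡ m) ∈ S
  ∈-collapse-zero {S} 0∈ with nonempty? (leftPart r⁺ S) | 0∈
  ... | yes (i , i∈) | _ = i , ∈-preimage⁻ {f = _↑ˡ m} i∈

  ∈-collapse-suc : ∀ {S j} → Fin.suc j ∈ collapse S → (r⁺ ↑ʳ j) ∈ S
  ∈-collapse-suc (there j∈) = ∈-preimage⁻ {f = r⁺ ↑ʳ_} j∈

  ∋-collapse-suc : ∀ {S j} → (r⁺ ↑ʳ j) ∈ S → Fin.suc j ∈ collapse S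
  ∋-collapse-suc j∈ = there (∈-preimage⁺ {f = r⁺ ↑ʳ_} j∈)

  IsClique-collapse : ∀ {S} → IsClique J S → IsClique K (collapse S)
  IsClique-collapse S-clique Fin.zero Fin.zero _ _ 0≢0 = contradiction refl 0≢0
  IsClique-collapse S-clique Fin.zero (Fin.suc j) _ _ _ = refl
  IsClique-collapse S-clique (Fin.suc j) Fin.zero _ _ _ = refl
  IsClique-collapse S-clique (Fin.suc j) (Fin.suc j′) j∈ j′∈ j≢j′ =
    trans (sym (J-rr j j′))
      (S-clique _ _ (∈-collapse-suc j∈) (∈-collapse-suc j′∈) (j≢j′ ∘ cong Fin.suc ∘ Fin.↑ʳ-injective r⁺ j j′))

module BlowUp (r : ℕ) (H : Graph m) where
  open BlowUpClique r H public
  private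
    r⁺ : ℕ
    r⁺ = suc r

  ω⁺ : ∀ {q} → OmegaLt K q → OmegaLt J q
  ω⁺ {q} ω<q S S-clique = subst (_< q) (∣collapse∣ S (∣left∣≤1 S-clique)) (ω<q _ (IsClique-collapse S-clique))

  ω⁻ : ∀ {q} → OmegaLt J q → OmegaLt K q
  ω⁻ {q} ω<q S S-clique = subst (_< q) (∣expand∣ S) (ω<q _ (IsClique-expand S-clique))

  colour⁻ : ∀ {s} → (Fin (r⁺ + m) → Fin s) → Fin (suc m) → Fin s
  colour⁻ c Fin.zero = c Fin.zero
  colour⁻ c (Fin.suc j) = c (r⁺ ↑ʳ j)

  colour⁺ : ∀ {s} → (Fin (suc m) → Fin s) → Fin (r⁺ + m) → Fin s
  colour⁺ c x = [ (λ _ → c Fin.zero) , c ∘ Fin.suc ]′ (Fin.splitAt r⁺ x)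

  colour⁺-left : ∀ {s} (c : Fin (suc m) → Fin s) i → colour⁺ c (i ↑ˡ m) ≡ c Fin.zero
  colour⁺-left c i = cong [ (λ _ → c Fin.zero) , c ∘ Fin.suc ]′ (Fin.splitAt-↑ˡ r⁺ i m)

  colour⁺-right : ∀ {s} (c : Fin (suc m) → Fin s) j → colour⁺ c (r⁺ ↑ʳ j) ≡ c (Fin.suc j)
  colour⁺-right c j = cong [ (λ _ → c Fin.zero) , c ∘ Fin.suc ]′ (Fin.splitAt-↑ʳ r⁺ m j)

  arrows⁺ : ∀ {s} {as : Vec ℕ s} → Arrows K as → Arrows J as
  arrows⁺ K→ c with i , S , S-clique , S-colour , ∣S∣ ← K→ (colour⁻ c)
    = i , expand S , IsClique-expand S-clique , colour S S-colour , trans (∣expand∣ S) ∣S∣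
    where
    colour : ∀ {i} S → (∀ x → x ∈ S → colour⁻ c x ≡ i) → ∀ x → x ∈ expand S → c x ≡ i
    colour (b ∷ S) S-colour x x∈ with splitView r⁺ m x
    ... | left _ with refl , refl ← ∈-expand-left {b} {S} x∈ = S-colour Fin.zero here
    colour (b ∷ S) S-colour x x∈ | right j = S-colour (Fin.suc j) (there (∈-expand-right {b} x∈))

  arrows⁻ : ∀ {s} {as : Vec ℕ s} → Arrows J as → Arrows K as
  arrows⁻ J→ c with i , S , S-clique , S-colour , ∣S∣ ← J→ (colour⁺ c)
    = i , collapse S , IsClique-collapse S-clique , colour , trans (∣collapse∣ S (∣left∣≤1 S-clique)) ∣S∣
    where
    colour : ∀ x → x ∈ collapse S → c x ≡ i
    colour Fin.zero 0∈ with i′ , i′∈ ← ∈-collapse-zero {S} 0∈ = trans (sym (colour⁺-left c i′)) (S-colour _ i′∈)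
    colour (Fin.suc j) j∈ = trans (sym (colour⁺-right c j)) (S-colour _ (∈-collapse-suc {S} j∈))

  PlusK⁻ : ∀ {q} → PlusK q J → PlusK q K
  PlusK⁻ {q} J-plus u v u≢v u≁v with i , j , refl , refl , i≁j ← Cone.nonedge H u≢v u≁v = new-clique i j u≢v i≁j
    where
    new-clique : ∀ i j (si≢sj : Fin.suc i ≢ Fin.suc j) → adj H i j ≡ false → NewClique q K _ _ si≢sj
    new-clique i j si≢sj i≁j = collapse-new (J-plus (r⁺ ↑ʳ i) (r⁺ ↑ʳ j) pi≢pj (trans (J-rr i j) i≁j))
      where
      i≢j : i ≢ j
      i≢j = si≢sj ∘ cong Fin.suc
      pi≢pj : r⁺ ↑ʳ i ≢ r⁺ ↑ʳ j
      pi≢pj = i≢j ∘ Fin.↑ʳ-injective r⁺ i j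
      H⁺ : Graph m
      H⁺ = addEdge H i j i≢j
      collapse-new : NewClique q J _ _ pi≢pj → NewClique q K _ _ si≢sj
      collapse-new (S , S-clique , ∣S∣ , S-new) =
        collapse S ,
        IsClique-addEdge-join⁺ K1 H i≢j si≢sj (BlowUpClique.IsClique-collapse r H⁺ S⁺-clique) ,
        trans (∣collapse∣ S (BlowUpClique.∣left∣≤1 r H⁺ S⁺-clique)) ∣S∣ ,
        ¬IsClique-nonedge K (∋-collapse-suc (proj₁ pij∈)) (∋-collapse-suc (proj₂ pij∈)) si≢sj i≁j
        where
        S⁺-clique : IsClique (join (empty r⁺) H⁺) S
        S⁺-clique = IsClique-addEdge-join⁻ (empty r⁺) H i≢j pi≢pj S-clique
        pij∈ : (r⁺ ↑ʳ i) ∈ S × (r⁺ ↑ʳ j) ∈ S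
        pij∈ = AddEdge.new-clique-∋xy J _ _ pi≢pj S-clique S-new

  PlusK⁺ : ∀ {q} → 2 ≤ q → (∃ λ Q → IsClique H Q × ∣ Q ∣ ≡ q ∸ 2) → PlusK q K → PlusK q J
  PlusK⁺ {q} 2≤q (Q , Q-clique , ∣Q∣) K-plus x y x≢y x≁y with splitView r⁺ m x | splitView r⁺ m y
  ... | left i | left i′ =
    pair i i′ ++ Q , clique , size ,
    ¬IsClique-nonedge J (∈-++⁺ˡ (x∈pair i i′)) (∈-++⁺ˡ (y∈pair i i′)) x≢y x≁y
    where
    clique : IsClique (addEdge J (i ↑ˡ m) (i′ ↑ˡ m) x≢y) (pair i i′ ++ Q)
    clique a b a∈ b∈ a≢b with splitView r⁺ m a | splitView r⁺ m b
    ... | left c | left d = AddEdge.adj⁺-endpoints J _ _ x≢y {c ↑ˡ m} {d ↑ˡ m}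
      (Endpoints-map (_↑ˡ m) (∈pair⇒Endpoints (∈-++⁻ˡ {S = pair i i′} a∈) (∈-++⁻ˡ {S = pair i i′} b∈) (a≢b ∘ cong (_↑ˡ m))))
    ... | left c | right d = AddEdge.adj⁺-old J _ _ x≢y {c ↑ˡ m} {r⁺ ↑ʳ d} (J-lr c d)
    ... | right c | left d = AddEdge.adj⁺-old J _ _ x≢y {r⁺ ↑ʳ c} {d ↑ˡ m} (J-rl c d)
    ... | right c | right d = AddEdge.adj⁺-old J _ _ x≢y {r⁺ ↑ʳ c} {r⁺ ↑ʳ d} (trans (J-rr c d)
      (Q-clique c d (∈-++⁻ʳ {S = pair i i′} a∈) (∈-++⁻ʳ {S = pair i i′} b∈) (a≢b ∘ cong (r⁺ ↑ʳ_))))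
    size : ∣ pair i i′ ++ Q ∣ ≡ q
    size = trans (∣p++q∣≡∣p∣+∣q∣ (pair i i′) Q) (trans (cong₂ _+_ (∣pair∣≡2 (x≢y ∘ cong (_↑ˡ m))) ∣Q∣) (ℕ.m+[n∸m]≡n 2≤q))
  ... | left i | right j with () ← trans (sym x≁y) (J-lr i j)
  ... | right j | left i with () ← trans (sym x≁y) (J-rl j i)
  ... | right j | right j′ =
    expand-new (K-plus (Fin.suc j) (Fin.suc j′) sj≢sj′ (trans (sym (J-rr j j′)) x≁y))
    where
    j≢j′ : j ≢ j′
    j≢j′ = x≢y ∘ cong (r⁺ ↑ʳ_)
    sj≢sj′ : Fin.suc j ≢ Fin.suc j′
    sj≢sj′ = j≢j′ ∘ Fin.suc-injective
    H⁺ : Graph m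
    H⁺ = addEdge H j j′ j≢j′
    expand-new : NewClique q K _ _ sj≢sj′ → NewClique q J _ _ x≢y
    expand-new (b ∷ S , S-clique , ∣S∣ , S-new) =
      expand (b ∷ S) ,
      IsClique-addEdge-join⁺ (empty r⁺) H j≢j′ x≢y
        (BlowUpClique.IsClique-expand r H⁺ (IsClique-addEdge-join⁻ K1 H j≢j′ sj≢sj′ S-clique)) ,
      trans (∣expand∣ (b ∷ S)) ∣S∣ ,
      ¬IsClique-nonedge J (∋-expand-right {b} (proj₁ sjj′∈)) (∋-expand-right {b} (proj₂ sjj′∈)) x≢y x≁y
      where
      sjj′∈ : Fin.suc j ∈ b ∷ S × Fin.suc j′ ∈ b ∷ S
      sjj′∈ = AddEdge.new-clique-∋xy K _ _ sj≢sj′ S-clique S-new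

  IsIndep-right : ∀ {S} → IsIndep J S → IsIndep H (rightPart r⁺ S)
  IsIndep-right S-indep a b a∈ b∈ =
    trans (sym (J-rr a b)) (S-indep _ _ (∈-preimage⁻ {f = r⁺ ↑ʳ_} a∈) (∈-preimage⁻ {f = r⁺ ↑ʳ_} b∈))

  α⁺ : ∀ {t} → suc r ≤ t → AlphaLe K t → AlphaLe J t
  α⁺ {t} 1+r≤t α≤t S S-indep with nonempty? (rightPart r⁺ S)
  ... | yes (j , j∈) = subst (_≤ t) (sym ∣S∣≡∣right∣) (Cone.α⁻ H α≤t _ (IsIndep-right S-indep))
    where
    left-empty : Empty (leftPart r⁺ S)
    left-empty (i , i∈) with () ← trans (sym (S-indep _ _ (∈-preimage⁻ {f = _↑ˡ m} i∈) (∈-preimage⁻ {f = r⁺ ↑ʳ_} j∈)))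
                                         (J-lr i j)
    ∣S∣≡∣right∣ : ∣ S ∣ ≡ ∣ rightPart r⁺ S ∣
    ∣S∣≡∣right∣ = trans (∣S∣≡∣left∣+∣right∣ r⁺ S) (cong (_+ ∣ rightPart r⁺ S ∣) (Empty⇒∣p∣≡0 left-empty))
  ... | no right-empty = subst (_≤ t) (sym ∣S∣≡∣left∣) (ℕ.≤-trans (∣p∣≤n (leftPart r⁺ S)) 1+r≤t)
    where
    ∣S∣≡∣left∣ : ∣ S ∣ ≡ ∣ leftPart r⁺ S ∣
    ∣S∣≡∣left∣ = trans (∣S∣≡∣left∣+∣right∣ r⁺ S)
      (trans (cong (∣ leftPart r⁺ S ∣ +_) (Empty⇒∣p∣≡0 right-empty)) (ℕ.+-identityʳ _))

  α⁻ : ∀ {t} → 1 ≤ t → AlphaLe J t → AlphaLe K t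
  α⁻ {t} 1≤t α≤t = Cone.α⁺ H 1≤t α≤t-H
    where
    α≤t-H : AlphaLe H t
    α≤t-H T T-indep = subst (_≤ t) (∣⊥++q∣≡∣q∣ {p = r⁺} T) (α≤t (⊥ ++ T) indep)
      where
      indep : IsIndep J (⊥ ++ T)
      indep x y x∈ y∈ with splitView r⁺ m x | splitView r⁺ m y
      ... | left _ | _ = contradiction (∈-++⁻ˡ {S = ⊥} x∈) ∉⊥
      ... | right _ | left _ = contradiction (∈-++⁻ˡ {S = ⊥} y∈) ∉⊥
      ... | right a | right b = trans (J-rr a b) (T-indep a b (∈-++⁻ʳ {S = ⊥} x∈) (∈-++⁻ʳ {S = ⊥} y∈))

  αGe : AlphaGe J (suc r)
  αGe = ⊤ {r⁺} ++ ⊥ {m} , indep , ℕ.≤-reflexive (sym (trans (∣p++⊥∣≡∣p∣ {m = m} (⊤ {r⁺})) (∣⊤∣≡n r⁺)))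
    where
    indep : IsIndep J (⊤ {r⁺} ++ ⊥ {m})
    indep x y x∈ y∈ with splitView r⁺ m x | splitView r⁺ m y
    ... | left a | left b = J-ll a b
    ... | left _ | right _ = contradiction (∈-++⁻ʳ {S = ⊤ {r⁺}} y∈) ∉⊥
    ... | right _ | _ = contradiction (∈-++⁻ʳ {S = ⊤ {r⁺}} x∈) ∉⊥

  exactlyOneCone : NoCone J → ExactlyOneCone K
  exactlyOneCone J-noCone = Fin.zero , Cone.zero-isCone H , unique
    where
    unique : ∀ w → IsCone K w → w ≡ Fin.zero
    unique Fin.zero _ = refl
    unique (Fin.suc j) j-cone = contradiction pj-cone (J-noCone (r⁺ ↑ʳ j))
      where
      pj-cone : IsCone J (r⁺ ↑ʳ j)
      pj-cone x x≢pj with splitView r⁺ m x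
      ... | left i = J-rl j i
      ... | right j′ = trans (J-rr j j′) (j-cone (Fin.suc j′) (x≢pj ∘ cong (r⁺ ↑ʳ_) ∘ Fin.suc-injective))

-- The extension G(N)

module ExtensionClique (H : Graph m) {r : ℕ} (Ms : Fin r → Subset m) where

  E : Graph (m + r)
  E = extend H Ms

  E-ll : ∀ i i′ → adj E (i ↑ˡ r) (i′ ↑ˡ r) ≡ adj H i i′
  E-ll = adj-extend-ll {H = H} {Ms = Ms}

  E-lr : ∀ i j → adj E (i ↑ˡ r) (m ↑ʳ j) ≡ lookup (Ms j) i
  E-lr = adj-extend-lr {H = H} {Ms = Ms}

  E-rl : ∀ j i → adj E (m ↑ʳ j) (i ↑ˡ r) ≡ lookup (Ms j) i
  E-rl = adj-extend-rl {H = H} {Ms = Ms}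

  E-rr : ∀ j j′ → adj E (m ↑ʳ j) (m ↑ʳ j′) ≡ false
  E-rr = adj-extend-rr {H = H} {Ms = Ms}

  adj⇒∈Ms : ∀ {a j} → adj E (m ↑ʳ j) (a ↑ˡ r) ≡ true → a ∈ Ms j
  adj⇒∈Ms {a} {j} ja = Vec.lookup⇒[]= a (Ms j) (trans (sym (E-rl j a)) ja)

  IsClique-left : ∀ {S} → IsClique E S → IsClique H (leftPart m S)
  IsClique-left S-clique a b a∈ b∈ a≢b = trans (sym (E-ll a b))
    (S-clique _ _ (∈-preimage⁻ {f = _↑ˡ r} a∈) (∈-preimage⁻ {f = _↑ˡ r} b∈) (a≢b ∘ Fin.↑ˡ-injective r a b))

  ∣right∣≤1 : ∀ {S} → IsClique E S → ∣ rightPart m S ∣ ≤ 1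
  ∣right∣≤1 S-clique = ∣p∣≤1 λ {j} {j′} j∈ j′∈ → decidable-stable (j Fin.≟ j′) λ j≢j′ →
    ¬IsClique-nonedge E (∈-preimage⁻ {f = m ↑ʳ_} j∈) (∈-preimage⁻ {f = m ↑ʳ_} j′∈) (j≢j′ ∘ Fin.↑ʳ-injective m j j′)
      (E-rr j j′) S-clique

  ∣S∣≤1+∣left∣ : ∀ {S} → IsClique E S → ∣ S ∣ ≤ suc ∣ leftPart m S ∣
  ∣S∣≤1+∣left∣ {S} S-clique = begin
    ∣ S ∣                                ≡⟨ ∣S∣≡∣left∣+∣right∣ m S ⟩
    ∣ leftPart m S ∣ + ∣ rightPart m S ∣ ≤⟨ ℕ.+-monoʳ-≤ ∣ leftPart m S ∣ (∣right∣≤1 S-clique) ⟩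
    ∣ leftPart m S ∣ + 1                ≡⟨ ℕ.+-comm _ 1 ⟩
    suc ∣ leftPart m S ∣                ∎
    where open ℕ.≤-Reasoning

  left⊆Ms : ∀ {S j} → IsClique E S → (m ↑ʳ j) ∈ S → leftPart m S ⊆ Ms j
  left⊆Ms S-clique j∈ a∈ = adj⇒∈Ms (S-clique _ _ j∈ (∈-preimage⁻ {f = _↑ˡ r} a∈) (↑ˡ≢↑ʳ ∘ sym))

module Extension (H : Graph m) {r : ℕ} (Ms : Fin r → Subset m) where
  open ExtensionClique H Ms public

  ∣S∣≡∣left∣ : (S : Subset (m + r)) → Empty (rightPart m S) → ∣ S ∣ ≡ ∣ leftPart m S ∣
  ∣S∣≡∣left∣ S right-empty =
    trans (∣S∣≡∣left∣+∣right∣ m S) (trans (cong (∣ leftPart m S ∣ +_) (Empty⇒∣p∣≡0 right-empty)) (ℕ.+-identityʳ _))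

  ω⁺ : ∀ {q} → 1 ≤ q → OmegaLt H q → (∀ j → ¬ ContainsK H (q ∸ 1) (Ms j)) → OmegaLt E q
  ω⁺ {q} 1≤q ω<q Ms-free S S-clique with nonempty? (rightPart m S)
  ... | no right-empty = subst (_< q) (sym (∣S∣≡∣left∣ S right-empty)) (ω<q _ (IsClique-left S-clique))
  ... | yes (j , j∈) with q ∸ 1 ℕ.≤? ∣ leftPart m S ∣
  ...   | yes q∸1≤∣left∣ with U , U⊆ , ∣U∣ ← ∃-⊆-ofSize (leftPart m S) (q ∸ 1) q∸1≤∣left∣ =
    contradiction (U , (λ {x} x∈ → left⊆Ms S-clique (∈-preimage⁻ {f = m ↑ʳ_} j∈) (U⊆ x∈)) ,
                   IsClique-⊆ H U⊆ (IsClique-left S-clique) , ∣U∣)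
                  (Ms-free j)
  ...   | no ∣left∣<q∸1 = begin-strict
    ∣ S ∣                                      ≤⟨ ∣S∣≤1+∣left∣ S-clique ⟩
    suc ∣ leftPart m S ∣                      <⟨ s≤s (ℕ.≰⇒> ∣left∣<q∸1) ⟩
    suc (q ∸ 1)                               ≡⟨ ℕ.m+[n∸m]≡n 1≤q ⟩
    q                                         ∎
    where open ℕ.≤-Reasoning

  ω⁻ : ∀ {q} → OmegaLt E q → OmegaLt H q
  ω⁻ {q} ω<q S S-clique = subst (_< q) (∣p++⊥∣≡∣p∣ S) (ω<q (S ++ ⊥) clique)
    where
    clique : IsClique E (S ++ ⊥)
    clique x y x∈ y∈ x≢y with splitView m r x | splitView m r y
    ... | left a | left b = trans (E-ll a b)
      (S-clique a b (∈-++⁻ˡ {T = ⊥} x∈) (∈-++⁻ˡ {T = ⊥} y∈) (x≢y ∘ cong (_↑ˡ r)))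
    ... | left _ | right _ = contradiction (∈-++⁻ʳ {S = S} y∈) ∉⊥
    ... | right _ | _ = contradiction (∈-++⁻ʳ {S = S} x∈) ∉⊥

  ¬K[q∸1] : ∀ {q} → 1 ≤ q → OmegaLt E q → ∀ j → ¬ ContainsK H (q ∸ 1) (Ms j)
  ¬K[q∸1] {q} 1≤q ω<q j (U , U⊆Ms , U-clique , ∣U∣) = ℕ.<-irrefl ∣U++j∣ (ω<q (U ++ ⁅ j ⁆) clique)
    where
    clique : IsClique E (U ++ ⁅ j ⁆)
    clique x y x∈ y∈ x≢y with splitView m r x | splitView m r y
    ... | left a | left b = trans (E-ll a b)
      (U-clique a b (∈-++⁻ˡ {S = U} x∈) (∈-++⁻ˡ {S = U} y∈) (x≢y ∘ cong (_↑ˡ r)))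
    ... | left a | right b rewrite x∈⁅y⁆⇒x≡y j (∈-++⁻ʳ {S = U} y∈) =
      trans (E-lr a j) (Vec.[]=⇒lookup (U⊆Ms (∈-++⁻ˡ {S = U} x∈)))
    ... | right a | left b rewrite x∈⁅y⁆⇒x≡y j (∈-++⁻ʳ {S = U} x∈) =
      trans (E-rl j b) (Vec.[]=⇒lookup (U⊆Ms (∈-++⁻ˡ {S = U} y∈)))
    ... | right a | right b = contradiction (cong (m ↑ʳ_) (trans (x∈⁅y⁆⇒x≡y j (∈-++⁻ʳ {S = U} x∈))
                                                           (sym (x∈⁅y⁆⇒x≡y j (∈-++⁻ʳ {S = U} y∈))))) x≢y
    ∣U++j∣ : ∣ U ++ ⁅ j ⁆ ∣ ≡ q
    ∣U++j∣ = begin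
      ∣ U ++ ⁅ j ⁆ ∣       ≡⟨ ∣p++q∣≡∣p∣+∣q∣ U ⁅ j ⁆ ⟩
      ∣ U ∣ + ∣ ⁅ j ⁆ ∣     ≡⟨ cong₂ _+_ ∣U∣ (∣⁅x⁆∣≡1 j) ⟩
      q ∸ 1 + 1           ≡⟨ ℕ.+-comm (q ∸ 1) 1 ⟩
      suc (q ∸ 1)         ≡⟨ ℕ.m+[n∸m]≡n 1≤q ⟩
      q                   ∎
      where open ≡-Reasoning

  IndepBound : ℕ → Set
  IndepBound t = ∀ (J : Subset r) (S : Subset m) → IsIndep H S →
    (∀ x → x ∈ S → ∀ j → j ∈ J → x ∉ Ms j) → ∣ S ∣ + ∣ J ∣ ≤ t

  α⁺ : ∀ {t} → IndepBound t → AlphaLe E t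
  α⁺ {t} bound S S-indep = subst (_≤ t) (sym (∣S∣≡∣left∣+∣right∣ m S))
    (bound (rightPart m S) (leftPart m S) left-indep avoids)
    where
    left-indep : IsIndep H (leftPart m S)
    left-indep a b a∈ b∈ =
      trans (sym (E-ll a b)) (S-indep _ _ (∈-preimage⁻ {f = _↑ˡ r} a∈) (∈-preimage⁻ {f = _↑ˡ r} b∈))
    avoids : ∀ x → x ∈ leftPart m S → ∀ j → j ∈ rightPart m S → x ∉ Ms j
    avoids x x∈ j j∈ x∈Ms with () ← trans (sym (S-indep _ _ (∈-preimage⁻ {f = _↑ˡ r} x∈) (∈-preimage⁻ {f = m ↑ʳ_} j∈)))
                                          (trans (E-lr x j) (Vec.[]=⇒lookup x∈Ms))

  α⁻ : ∀ {t} → AlphaLe E t → IndepBound t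
  α⁻ {t} α≤t J S S-indep avoids = subst (_≤ t) (∣p++q∣≡∣p∣+∣q∣ S J) (α≤t (S ++ J) indep)
    where
    indep : IsIndep E (S ++ J)
    indep x y x∈ y∈ with splitView m r x | splitView m r y
    ... | left a | left b = trans (E-ll a b) (S-indep a b (∈-++⁻ˡ {S = S} x∈) (∈-++⁻ˡ {S = S} y∈))
    ... | left a | right b = trans (E-lr a b)
      (x∉p⇒lookup≡false (Ms b) (avoids a (∈-++⁻ˡ {S = S} x∈) b (∈-++⁻ʳ {S = S} y∈)))
    ... | right a | left b = trans (E-rl a b)
      (x∉p⇒lookup≡false (Ms a) (avoids b (∈-++⁻ˡ {S = S} y∈) a (∈-++⁻ʳ {S = S} x∈)))
    ... | right a | right b = E-rr a b

  αH : ∀ {t} → AlphaLe E t → AlphaLe H t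
  αH {t} α≤t S S-indep = subst (_≤ t) ∣S∣+0 (α⁻ α≤t ⊥ S S-indep λ _ _ j j∈⊥ → contradiction j∈⊥ ∉⊥)
    where
    ∣S∣+0 : ∣ S ∣ + ∣ ⊥ {r} ∣ ≡ ∣ S ∣
    ∣S∣+0 = trans (cong (∣ S ∣ +_) (∣⊥∣≡0 r)) (ℕ.+-identityʳ _)

  αGe : AlphaGe E r
  αGe = ⊥ {m} ++ ⊤ {r} , indep , ℕ.≤-reflexive (sym (trans (∣⊥++q∣≡∣q∣ {p = m} (⊤ {r})) (∣⊤∣≡n r)))
    where
    indep : IsIndep E (⊥ {m} ++ ⊤ {r})
    indep x y x∈ y∈ with splitView m r x | splitView m r y
    ... | left _ | _ = contradiction (∈-++⁻ˡ {S = ⊥} x∈) ∉⊥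
    ... | right _ | left _ = contradiction (∈-++⁻ˡ {S = ⊥} y∈) ∉⊥
    ... | right a | right b = E-rr a b

  colourˡ : ∀ {s} → (Fin m → Fin (suc s)) → Fin (m + r) → Fin (suc s)
  colourˡ c x = [ c , (λ _ → Fin.zero) ]′ (Fin.splitAt m x)

  colourˡ-left : ∀ {s} (c : Fin m → Fin (suc s)) x → colourˡ c (x ↑ˡ r) ≡ c x
  colourˡ-left c x = cong [ c , (λ _ → Fin.zero) ]′ (Fin.splitAt-↑ˡ m x r)

  colourˡ-right : ∀ {s} (c : Fin m → Fin (suc s)) j → colourˡ c (m ↑ʳ j) ≡ Fin.zero
  colourˡ-right c j = cong [ c , (λ _ → Fin.zero) ]′ (Fin.splitAt-↑ʳ m r j)

  arrows⁻ : ∀ {a s} {as : Vec ℕ s} → Arrows E (a ∷ as) → Arrows H ((a ∸ 1) ∷ as)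
  arrows⁻ {a} E→ c with E→ (colourˡ c)
  ... | Fin.zero , S , S-clique , S-colour , ∣S∣
    with U , U⊆ , ∣U∣ ← ∃-⊆-ofSize (leftPart m S) (a ∸ 1)
                          (ℕ.∸-monoˡ-≤ 1 (subst (_≤ suc ∣ leftPart m S ∣) ∣S∣ (∣S∣≤1+∣left∣ S-clique)))
    = Fin.zero , U , IsClique-⊆ H U⊆ (IsClique-left S-clique) ,
      (λ x x∈ → trans (sym (colourˡ-left c x)) (S-colour _ (∈-preimage⁻ {f = _↑ˡ r} (U⊆ x∈)))) , ∣U∣
  ... | Fin.suc i , S , S-clique , S-colour , ∣S∣ =
    Fin.suc i , leftPart m S , IsClique-left S-clique ,
    (λ x x∈ → trans (sym (colourˡ-left c x)) (S-colour _ (∈-preimage⁻ {f = _↑ˡ r} x∈))) ,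
    trans (sym (∣S∣≡∣left∣ S right-empty)) ∣S∣
    where
    right-empty : Empty (rightPart m S)
    right-empty (j , j∈) with () ← trans (sym (colourˡ-right c j)) (S-colour _ (∈-preimage⁻ {f = m ↑ʳ_} j∈))

  PlusK⁻ : ∀ {q} → 3 ≤ q → PlusK q E → PlusK (q ∸ 1) H
  PlusK⁻ {q} 3≤q E-plus i j i≢j i≁j = restrict (E-plus (i ↑ˡ r) (j ↑ˡ r) ii≢jj (trans (E-ll i j) i≁j))
    where
    ii≢jj : i ↑ˡ r ≢ j ↑ˡ r
    ii≢jj = i≢j ∘ Fin.↑ˡ-injective r i j
    H⁺ : Graph m
    H⁺ = addEdge H i j i≢j
    restrict : NewClique q E _ _ ii≢jj → NewClique (q ∸ 1) H i j i≢j
    restrict (S , S-clique , ∣S∣ , S-new) = pick (∃-⊆-between (pair i j) (leftPart m S) (q ∸ 1) pair⊆left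
      (ℕ.≤-trans (ℕ.≤-reflexive (∣pair∣≡2 i≢j)) (ℕ.∸-monoˡ-≤ 1 3≤q))
      (ℕ.∸-monoˡ-≤ 1 (subst (_≤ suc ∣ leftPart m S ∣) ∣S∣ (ExtensionClique.∣S∣≤1+∣left∣ H⁺ Ms S⁺-clique))))
      where
      S⁺-clique : IsClique (extend H⁺ Ms) S
      S⁺-clique = IsClique-≗ (addEdge E _ _ ii≢jj) (extend H⁺ Ms) (addEdge-extend-≗ H Ms i≢j ii≢jj) S-clique
      ij∈ : (i ↑ˡ r) ∈ S × (j ↑ˡ r) ∈ S
      ij∈ = AddEdge.new-clique-∋xy E _ _ ii≢jj S-clique S-new
      pair⊆left : pair i j ⊆ leftPart m S
      pair⊆left z∈ with ∈pair⇒ z∈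
      ... | inj₁ refl = ∈-preimage⁺ {f = _↑ˡ r} (proj₁ ij∈)
      ... | inj₂ refl = ∈-preimage⁺ {f = _↑ˡ r} (proj₂ ij∈)
      pick : (∃ λ U → pair i j ⊆ U × U ⊆ leftPart m S × ∣ U ∣ ≡ q ∸ 1) → NewClique (q ∸ 1) H i j i≢j
      pick (U , pair⊆U , U⊆ , ∣U∣) =
        U , IsClique-⊆ H⁺ U⊆ (ExtensionClique.IsClique-left H⁺ Ms S⁺-clique) , ∣U∣ ,
        ¬IsClique-nonedge H (pair⊆U (x∈pair i j)) (pair⊆U (y∈pair i j)) i≢j i≁j

  maxFree : ∀ {q} → 1 ≤ q → PlusK q E → OmegaLt E q → ∀ j → MaxFree H q (Ms j)
  maxFree {q} 1≤q E-plus ω<q j = ¬K[q∸1] 1≤q ω<q j , maximal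
    where
    maximal : ∀ M′ → Ms j ⊂ M′ → ContainsK H (q ∸ 1) M′
    maximal M′ (Ms⊆M′ , w , w∈M′ , w∉Ms) = grow (PlusK⇒NewClique∖x E E-plus {m ↑ʳ j} {w ↑ˡ r} (↑ˡ≢↑ʳ ∘ sym)
      (trans (E-rl j w) (x∉p⇒lookup≡false (Ms j) w∉Ms)))
      where
      grow : NewClique∖x q E (m ↑ʳ j) (w ↑ˡ r) → ContainsK H (q ∸ 1) M′
      grow (C , C-clique , _ , q≤1+∣C∣ , adj-j) =
        pick (∃-⊆-ofSize (leftPart m C) (q ∸ 1) (ℕ.∸-monoˡ-≤ 1 (subst (λ n → q ≤ suc n) (∣S∣≡∣left∣ C right-empty) q≤1+∣C∣)))
        where
        right-empty : Empty (rightPart m C)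
        right-empty (b , b∈) with () ← trans (sym (adj-j (∈-preimage⁻ {f = m ↑ʳ_} b∈) (↑ˡ≢↑ʳ ∘ sym)))
                                             (E-rr j b)
        left⊆M′ : leftPart m C ⊆ M′
        left⊆M′ {a} a∈ with a Fin.≟ w
        ... | yes refl = w∈M′
        ... | no a≢w = Ms⊆M′ (adj⇒∈Ms (adj-j (∈-preimage⁻ {f = _↑ˡ r} a∈) (a≢w ∘ Fin.↑ˡ-injective r a w)))
        pick : (∃ λ U → U ⊆ leftPart m C × ∣ U ∣ ≡ q ∸ 1) → ContainsK H (q ∸ 1) M′
        pick (U , U⊆ , ∣U∣) = U , left⊆M′ ∘ U⊆ , IsClique-⊆ H U⊆ (IsClique-left C-clique) , ∣U∣

  common : ∀ {q} → PlusK q E → ∀ i j → i ≢ j → ContainsK H (q ∸ 2) (Ms i ∩ Ms j)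
  common {q} E-plus i j i≢j =
    shrink (PlusK⇒NewClique∖x E E-plus {m ↑ʳ i} {m ↑ʳ j} (i≢j ∘ Fin.↑ʳ-injective m i j) (E-rr i j))
    where
    shrink : NewClique∖x q E (m ↑ʳ i) (m ↑ʳ j) → ContainsK H (q ∸ 2) (Ms i ∩ Ms j)
    shrink (C , C-clique , j∈C , q≤1+∣C∣ , adj-i) =
      pick (∃-⊆-ofSize (leftPart m C) (q ∸ 2) (ℕ.∸-monoˡ-≤ 2 (ℕ.≤-trans q≤1+∣C∣ (s≤s (∣S∣≤1+∣left∣ C-clique)))))
      where
      left⊆ : leftPart m C ⊆ Ms i ∩ Ms j
      left⊆ a∈ = x∈p∩q⁺ (adj⇒∈Ms (adj-i (∈-preimage⁻ {f = _↑ˡ r} a∈) ↑ˡ≢↑ʳ) , left⊆Ms C-clique j∈C a∈)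
      pick : (∃ λ U → U ⊆ leftPart m C × ∣ U ∣ ≡ q ∸ 2) → ContainsK H (q ∸ 2) (Ms i ∩ Ms j)
      pick (U , U⊆ , ∣U∣) = U , left⊆ ∘ U⊆ , IsClique-⊆ H U⊆ (IsClique-left C-clique) , ∣U∣

-- Twins in maximal K_q-free graphs

NoCone⇒non-neighbour : (G : Graph k) → NoCone G → ∀ {A w} → (∀ u → u ∉ A → u ≢ w → adj G w u ≡ true) →
  ∃ λ v → v ∈ A × adj G w v ≡ false
NoCone⇒non-neighbour G G-noCone {A} {w} w-adj with Fin.any? (λ a → (a ∈? A) ×-dec (adj G w a Data.Bool.Properties.≟ false))
... | yes v = v
... | no ¬v = contradiction w-cone (G-noCone w)
  where
  w-cone : IsCone G w
  w-cone x x≢w with x ∈? A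
  ... | no x∉A = w-adj x x∉A x≢w
  ... | yes x∈A with adj G w x in wx
  ...   | true = refl
  ...   | false = contradiction (x , x∈A , wx) ¬v

module Twins (G : Graph k) {q : ℕ} (G-plus : PlusK q G) (ω<q : OmegaLt G q) where

  IsClique-∪⁅x⁆ : ∀ {C x} → IsClique G C → (∀ z → z ∈ C → z ≢ x → adj G x z ≡ true) → IsClique G (C ∪ ⁅ x ⁆)
  IsClique-∪⁅x⁆ {C} {x} C-clique x-adj u v u∈ v∈ u≢v with x∈p∪q⁻ C ⁅ x ⁆ u∈ | x∈p∪q⁻ C ⁅ x ⁆ v∈
  ... | inj₁ u∈C | inj₁ v∈C = C-clique u v u∈C v∈C u≢v
  ... | inj₁ u∈C | inj₂ v∈x rewrite x∈⁅y⁆⇒x≡y x v∈x = trans (Graph.adj-sym G u x) (x-adj u u∈C u≢v)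
  ... | inj₂ u∈x | inj₁ v∈C rewrite x∈⁅y⁆⇒x≡y x u∈x = x-adj v v∈C (u≢v ∘ sym)
  ... | inj₂ u∈x | inj₂ v∈x = contradiction (trans (x∈⁅y⁆⇒x≡y x u∈x) (sym (x∈⁅y⁆⇒x≡y x v∈x))) u≢v

  -- If u ∉ N(v), the new clique through vu minus v, together with w, would be a q-clique of G.
  twin : ∀ {v w} → adj G v w ≡ false → (∀ u → adj G v u ≡ true → adj G w u ≡ true) →
    ∀ u → adj G w u ≡ true → adj G v u ≡ true
  twin {v} {w} v≁w N[v]⊆N[w] u wu with adj G v u in vu
  ... | true = refl
  ... | false = contradiction (PlusK⇒NewClique∖x G G-plus v≢u vu) no-clique
    where
    v≢u : v ≢ u
    v≢u refl with () ← trans (sym wu) (trans (Graph.adj-sym G w v) v≁w)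
    no-clique : ¬ NewClique∖x q G v u
    no-clique (C , C-clique , u∈C , q≤1+∣C∣ , v-adj) = ℕ.<-irrefl refl (begin-strict
      q                 ≤⟨ q≤1+∣C∣ ⟩
      suc ∣ C ∣          ≡⟨ sym (∣p∪⁅x⁆∣≡1+∣p∣ w∉C) ⟩
      ∣ C ∪ ⁅ w ⁆ ∣      <⟨ ω<q _ (IsClique-∪⁅x⁆ C-clique w-adj) ⟩
      q                 ∎)
      where
      open ℕ.≤-Reasoning
      w-adj : ∀ z → z ∈ C → z ≢ w → adj G w z ≡ true
      w-adj z z∈ _ with z Fin.≟ u
      ... | yes refl = wu
      ... | no z≢u = N[v]⊆N[w] z (v-adj z∈ z≢u)
      w∉C : w ∉ C
      w∉C w∈ with () ← trans (sym (v-adj w∈ λ { refl → case trans (sym wu) (irrefl G w) of λ () })) v≁w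

  -- w has a non-neighbour in A (G has no cone), so by `twin` it has the neighbourhood of that vertex, hence is
  -- non-adjacent to all of A, hence (`twin` again) has the neighbourhood of every vertex of A.
  twin-class : NoCone G → ∀ {A w} → IsIndep G A → w ∉ A → (∀ u → u ∉ A → u ≢ w → adj G w u ≡ true) →
    IsIndep G (A ∪ ⁅ w ⁆) × (∀ b x → b ∈ A ∪ ⁅ w ⁆ → x ∉ A ∪ ⁅ w ⁆ → adj G b x ≡ true)
  twin-class G-noCone {A} {w} A-indep w∉A w-adj = B-indep , B-joined
    where
    N[w]⊆N[a] : ∀ {a} → a ∈ A → adj G w a ≡ false → ∀ u → adj G w u ≡ true → adj G a u ≡ true
    N[w]⊆N[a] {a} a∈A w≁a = twin (trans (Graph.adj-sym G a w) w≁a) N[a]⊆N[w]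
      where
      N[a]⊆N[w] : ∀ u → adj G a u ≡ true → adj G w u ≡ true
      N[a]⊆N[w] u au = w-adj u u∉A u≢w
        where
        u∉A : u ∉ A
        u∉A u∈A with () ← trans (sym au) (A-indep a u a∈A u∈A)
        u≢w : u ≢ w
        u≢w refl with () ← trans (sym au) (trans (Graph.adj-sym G a w) w≁a)
    w≁A : ∀ {a} → a ∈ A → adj G w a ≡ false
    w≁A {a} a∈A with adj G w a in wa | NoCone⇒non-neighbour G G-noCone w-adj
    ... | false | _ = refl
    ... | true | v , v∈A , w≁v with () ← trans (sym (N[w]⊆N[a] v∈A w≁v a wa)) (A-indep v a v∈A a∈A)
    ∈B⇒ : ∀ {x} → x ∈ A ∪ ⁅ w ⁆ → x ∈ A ⊎ x ≡ w
    ∈B⇒ x∈ = Data.Sum.map₂ (x∈⁅y⁆⇒x≡y w) (x∈p∪q⁻ A ⁅ w ⁆ x∈)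
    B-indep : IsIndep G (A ∪ ⁅ w ⁆)
    B-indep x y x∈ y∈ with ∈B⇒ x∈ | ∈B⇒ y∈
    ... | inj₁ x∈A | inj₁ y∈A = A-indep x y x∈A y∈A
    ... | inj₁ x∈A | inj₂ refl = trans (Graph.adj-sym G x w) (w≁A x∈A)
    ... | inj₂ refl | inj₁ y∈A = w≁A y∈A
    ... | inj₂ refl | inj₂ refl = irrefl G w
    w-joined : ∀ x → x ∉ A ∪ ⁅ w ⁆ → adj G w x ≡ true
    w-joined x x∉ = w-adj x (x∉ ∘ x∈p∪q⁺ ∘ inj₁) λ { refl → x∉ (x∈p∪q⁺ (inj₂ (x∈⁅x⁆ w))) }
    B-joined : ∀ b x → b ∈ A ∪ ⁅ w ⁆ → x ∉ A ∪ ⁅ w ⁆ → adj G b x ≡ true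
    B-joined b x b∈ x∉ with ∈B⇒ b∈
    ... | inj₁ b∈A = N[w]⊆N[a] b∈A (w≁A b∈A) x (w-joined x x∉)
    ... | inj₂ refl = w-joined x x∉

n∸r+r≡n : ∀ n r → 1 ≤ n ∸ r → n ∸ r + r ≡ n
n∸r+r≡n n r 1≤n∸r = ℕ.m∸n+n≡m {n} {r} (ℕ.<⇒≤ (ℕ.m∸n≢0⇒n<m (ℕ.m<n⇒n≢0 1≤n∸r)))

module Main (a₁ : ℕ) {s : ℕ} (as : Vec ℕ s) (q n r t : ℕ)
  (2≤a₁ : 2 ≤ a₁) (as≥1 : All (1 ≤_) as) (1≤q : 1 ≤ q) (1≤n : 1 ≤ n) (1≤t : 1 ≤ t) where

  open AlgorithmB a₁ as q n r t using (InB; step2; step5; step6; full; red)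

  1+[q∸1]≡q : suc (q ∸ 1) ≡ q
  1+[q∸1]≡q = ℕ.m+[n∸m]≡n 1≤q

  3≤q : ∀ (G : Graph k) → Arrows G full → OmegaLt G q → 3 ≤ q
  3≤q G G→ ω<q with S , S-clique , ∣S∣ ← Arrows⇒clique G as≥1 G→ = ℕ.≤-trans (s≤s 2≤a₁) (subst (_< q) ∣S∣ (ω<q S S-clique))

  H-vertex : (H : Graph m) → Arrows (join K1 H) full → Fin m
  H-vertex H K→ with S , _ , ∣S∣ ← Arrows⇒clique (join K1 H) as≥1 K→ = 2≤∣p∣⇒Fin S (subst (2 ≤_) (sym ∣S∣) 2≤a₁)

  cone-sound : (H : Graph m) → InHMaxT red (q ∸ 1) (n ∸ 1) t H → AlphaGe H r → Arrows (join K1 H) full →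
    InHMaxT full q n t (join K1 H) × AlphaGe (join K1 H) r
  cone-sound H ((m≡n∸1 , _ , ω<q∸1) , H-plus , α≤t) α≥r K→ =
    ((trans (cong suc m≡n∸1) (ℕ.m+[n∸m]≡n 1≤n) , K→ , subst (OmegaLt (join K1 H)) 1+[q∸1]≡q (Cone.ω⁺ H ω<q∸1)) ,
     subst (λ q → PlusK q (join K1 H)) 1+[q∸1]≡q (Cone.PlusK⁺ H H-plus) , Cone.α⁺ H 1≤t α≤t) ,
    Cone.αGe⁺ H α≥r

  cone-complete : (H : Graph m) → InHMaxT full q n t (join K1 H) → AlphaGe (join K1 H) r →
    InHMaxT red (q ∸ 1) (n ∸ 1) t H × AlphaGe H r
  cone-complete H ((1+m≡n , K→ , ω<q) , K-plus , α≤t) α≥r =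
    ((cong (_∸ 1) 1+m≡n , Cone.arrows⁻ H K→ , ω<q∸1) ,
     Cone.PlusK⁻ H ω<q∸1 (subst (λ q → PlusK q (join K1 H)) (sym 1+[q∸1]≡q) K-plus) , Cone.α⁻ H α≤t) ,
    Cone.αGe⁻ H (H-vertex H K→) α≥r
    where
    ω<q∸1 : OmegaLt H (q ∸ 1)
    ω<q∸1 = Cone.ω⁻ H (subst (OmegaLt (join K1 H)) (sym 1+[q∸1]≡q) ω<q)

  extension-sound : (H : Graph m) (Ms : Fin r → Subset m) → InHPlusT red (q ∸ 1) q (n ∸ r) t H →
    ValidN H q t Ms → AllAddEdgeOmegaEq (extend H Ms) q → Arrows (extend H Ms) full →
    InHMaxT full q n t (extend H Ms) × AlphaGe (extend H Ms) r
  extension-sound {m} H Ms ((m≡n∸r , H→ , ω<q) , _) (Ms-maxFree , _ , bound) all-ω≡q E→ =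
    ((m+r≡n , E→ , ω<q-E) , AllAddEdgeOmegaEq⇒PlusK (extend H Ms) all-ω≡q ω<q-E , Extension.α⁺ H Ms bound) ,
    Extension.αGe H Ms
    where
    ω<q-E : OmegaLt (extend H Ms) q
    ω<q-E = Extension.ω⁺ H Ms 1≤q ω<q (proj₁ ∘ Ms-maxFree)
    1≤m : 1 ≤ m
    1≤m with S , _ , ∣S∣ ← Arrows⇒clique H as≥1 H→ =
      ℕ.≤-trans (ℕ.∸-monoˡ-≤ 1 2≤a₁) (subst (_≤ m) ∣S∣ (∣p∣≤n S))
    m+r≡n : m + r ≡ n
    m+r≡n = trans (cong (_+ r) m≡n∸r) (n∸r+r≡n n r (subst (1 ≤_) m≡n∸r 1≤m))

  extension-complete : (H : Graph m) (Ms : Fin r → Subset m) → InHMaxT full q n t (extend H Ms) →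
    InHPlusT red (q ∸ 1) q (n ∸ r) t H × ValidN H q t Ms × AllAddEdgeOmegaEq (extend H Ms) q
  extension-complete {m} H Ms ((m+r≡n , E→ , ω<q) , E-plus , α≤t) =
    ((m≡n∸r , Extension.arrows⁻ H Ms E→ , Extension.ω⁻ H Ms ω<q) ,
     Extension.PlusK⁻ H Ms (3≤q (extend H Ms) E→ ω<q) E-plus , Extension.αH H Ms α≤t) ,
    (Extension.maxFree H Ms 1≤q E-plus ω<q , Extension.common H Ms E-plus , Extension.α⁻ H Ms α≤t) ,
    PlusK⇒AllAddEdgeOmegaEq (extend H Ms) E-plus ω<q
    where
    m≡n∸r : m ≡ n ∸ r
    m≡n∸r = sym (trans (cong (_∸ r) (sym m+r≡n)) (ℕ.m+n∸n≡m m r))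

  blowup-sound : (H : Graph m) → r < t → InHMaxT red q (n ∸ r) t (join K1 H) → ExactlyOneCone (join K1 H) →
    Arrows (join K1 H) full → InHMaxT full q n t (join (empty (suc r)) H) × AlphaGe (join (empty (suc r)) H) r
  blowup-sound {m} H r<t ((1+m≡n∸r , _ , ω<q) , K-plus , α≤t) K-cone K→ =
    ((1+r+m≡n , BlowUp.arrows⁺ r H {as = full} K→ , BlowUp.ω⁺ r H ω<q) ,
     BlowUp.PlusK⁺ r H (ℕ.≤-trans (ℕ.n≤1+n 2) (3≤q (join K1 H) K→ ω<q)) (Cone.∃K[q∸2] H K-plus K-cone (H-vertex H K→)) K-plus ,
     BlowUp.α⁺ r H r<t α≤t) ,
    AlphaGe-weaken (join (empty (suc r)) H) (ℕ.n≤1+n r) (BlowUp.αGe r H)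
    where
    1+r+m≡n : suc r + m ≡ n
    1+r+m≡n = begin
      suc r + m ≡⟨ cong suc (ℕ.+-comm r m) ⟩
      suc m + r ≡⟨ cong (_+ r) 1+m≡n∸r ⟩
      n ∸ r + r ≡⟨ n∸r+r≡n n r (subst (1 ≤_) 1+m≡n∸r (s≤s z≤n)) ⟩
      n         ∎
      where open ≡-Reasoning

  blowup-complete : (H : Graph m) → InHMaxT full q n t (join (empty (suc r)) H) → NoCone (join (empty (suc r)) H) →
    InHMaxT red q (n ∸ r) t (join K1 H) × ExactlyOneCone (join K1 H) × Arrows (join K1 H) full
  blowup-complete {m} H ((1+r+m≡n , J→ , ω<q) , J-plus , α≤t) J-noCone =
    ((1+m≡n∸r , arrows-mono (join K1 H) (ℕ.m∸n≤m a₁ 1) K→ , BlowUp.ω⁻ r H ω<q) , BlowUp.PlusK⁻ r H J-plus ,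
     BlowUp.α⁻ r H 1≤t α≤t) ,
    BlowUp.exactlyOneCone r H J-noCone , K→
    where
    K→ : Arrows (join K1 H) full
    K→ = BlowUp.arrows⁻ r H {as = full} J→
    1+m≡n∸r : suc m ≡ n ∸ r
    1+m≡n∸r = sym (trans (cong (_∸ r) (sym 1+r+m≡n)) (trans (cong (_∸ r) (sym (ℕ.+-suc r m))) (ℕ.m+n∸m≡n r (suc m))))

  InB-sound : ∀ {k} {G : Graph k} → InB G → InHMaxT full q n t G × AlphaGe G r
  InB-sound (step2 H H∈ _ Ms Ms-valid all-ω≡q E→) = extension-sound H Ms H∈ Ms-valid all-ω≡q E→
  InB-sound (step5 F H r<t F∈ F-cone F≅K K→) =
    blowup-sound H r<t (Iso-invariance.inHPlusT F (join K1 H) F≅K {as = red} F∈)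
      (Iso-invariance.exactlyOneCone F (join K1 H) F≅K F-cone) K→
  InB-sound (step6 H H∈ α≥r K→) = cone-sound H H∈ α≥r K→

  sound : ∀ {k k′} (G′ : Graph k′) (G : Graph k) → InB G′ → Iso G′ G → InHMaxT full q n t G × AlphaGe G r
  sound G′ G G′∈B G′≅G with G′∈ , α≥r ← InB-sound G′∈B =
    Iso-invariance.inHPlusT G′ G G′≅G {as = full} G′∈ , Iso-invariance.alphaGe G′ G G′≅G α≥r

  InB-upto-Iso : ∀ {k} → Graph k → Set
  InB-upto-Iso G = ∃ λ k′ → Σ (Graph k′) λ G′ → InB G′ × Iso G′ G

  complete-cone : (G : Graph k) → InHMaxT full q n t G → AlphaGe G r → ∀ v → IsCone G v → InB-upto-Iso G
  complete-cone G G∈ α≥r v v-cone = _ , K , step6 H (proj₁ H∈) (proj₂ H∈) (proj₁ (proj₂ (proj₁ K∈))) , G≅K⁻¹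
    where
    G≅K⁻¹ : Iso (join K1 (G ∖ ⁅ v ⁆)) G
    G≅K⁻¹ = join-decomposition G ⁅ v ⁆ (IsIndep-⁅x⁆ G v)
      (λ b x b∈ x∉ → subst (λ b → adj G b x ≡ true) (sym (x∈⁅y⁆⇒x≡y v b∈)) (v-cone x λ { refl → x∉ (x∈⁅x⁆ x) }))
      1 (∣⁅x⁆∣≡1 v)
    H : Graph ∣ ∁ ⁅ v ⁆ ∣
    H = G ∖ ⁅ v ⁆
    K : Graph (suc ∣ ∁ ⁅ v ⁆ ∣)
    K = join K1 H
    K∈ : InHMaxT full q n t K
    K∈ = Iso-invariance.inHPlusT G K (Iso-sym {G = K} {G′ = G} G≅K⁻¹) {as = full} G∈
    H∈ : InHMaxT red (q ∸ 1) (n ∸ 1) t H × AlphaGe H r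
    H∈ = cone-complete H K∈ (Iso-invariance.alphaGe G K (Iso-sym {G = K} {G′ = G} G≅K⁻¹) α≥r)

  complete-extension : (G : Graph k) → InHMaxT full q n t G → (A : Subset k) → IsIndep G A → ∣ A ∣ ≡ r →
    NoCone (G ∖ A) → InB-upto-Iso G
  complete-extension G G∈ A A-indep ∣A∣ H-noCone
    with Ms , E≅G ← extension-decomposition G A A-indep r ∣A∣
    with E∈@((_ , E→ , _) , _) ← Iso-invariance.inHPlusT G (extend (G ∖ A) Ms)
                                    (Iso-sym {G = extend (G ∖ A) Ms} {G′ = G} E≅G) {as = full} G∈
    with H∈ , Ms-valid , all-ω≡q ← extension-complete (G ∖ A) Ms E∈
    = _ , extend (G ∖ A) Ms , step2 (G ∖ A) H∈ H-noCone Ms Ms-valid all-ω≡q E→ , E≅G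

  complete-twin : (G : Graph k) → InHMaxT full q n t G → NoCone G → (A : Subset k) → IsIndep G A → ∣ A ∣ ≡ r →
    (w₀ : Fin ∣ ∁ A ∣) → IsCone (G ∖ A) w₀ → InB-upto-Iso G
  complete-twin {k} G G∈@((_ , _ , ω<q) , G-plus , α≤t) G-noCone A A-indep ∣A∣ w₀ w₀-cone =
    _ , J , step5 K H r<t (proj₁ K∈) (proj₁ (proj₂ K∈)) (Iso-refl {G = K}) (proj₂ (proj₂ K∈)) , J≅G
    where
    w : Fin k
    w = fromParts A (inj₂ w₀)
    w∉A : w ∉ A
    w∉A = fromParts-outside A w₀
    w-adj : ∀ u → u ∉ A → u ≢ w → adj G w u ≡ true
    w-adj u u∉A u≢w with j , refl ← x∉A⇒fromParts A u∉A = w₀-cone j (u≢w ∘ cong (fromParts A ∘ inj₂))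
    B : Subset k
    B = A ∪ ⁅ w ⁆
    B-class : IsIndep G B × (∀ b x → b ∈ B → x ∉ B → adj G b x ≡ true)
    B-class = Twins.twin-class G G-plus ω<q G-noCone A-indep w∉A w-adj
    ∣B∣ : ∣ B ∣ ≡ suc r
    ∣B∣ = trans (∣p∪⁅x⁆∣≡1+∣p∣ w∉A) (cong suc ∣A∣)
    H : Graph ∣ ∁ B ∣
    H = G ∖ B
    J : Graph (suc r + ∣ ∁ B ∣)
    J = join (empty (suc r)) H
    J≅G : Iso J G
    J≅G = join-decomposition G B (proj₁ B-class) (proj₂ B-class) (suc r) ∣B∣
    J≅G⁻¹ : Iso G J
    J≅G⁻¹ = Iso-sym {G = J} {G′ = G} J≅G
    r<t : r < t
    r<t = subst (_≤ t) ∣B∣ (α≤t B (proj₁ B-class))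
    K : Graph (suc ∣ ∁ B ∣)
    K = join K1 H
    K∈ : InHMaxT red q (n ∸ r) t K × ExactlyOneCone K × Arrows K full
    K∈ = blowup-complete H (Iso-invariance.inHPlusT G J J≅G⁻¹ {as = full} G∈) (Iso-invariance.noCone G J J≅G⁻¹ G-noCone)

  complete : (G : Graph k) → InHMaxT full q n t G → AlphaGe G r → InB-upto-Iso G
  complete G G∈ α≥r@(A₀ , A₀-indep , r≤∣A₀∣) with cone? G
  ... | inj₁ (v , v-cone) = complete-cone G G∈ α≥r v v-cone
  ... | inj₂ G-noCone with A , A⊆A₀ , ∣A∣ ← ∃-⊆-ofSize A₀ r r≤∣A₀∣ with cone? (G ∖ A)
  ...   | inj₂ H-noCone = complete-extension G G∈ A (IsIndep-⊆ G A⊆A₀ A₀-indep) ∣A∣ H-noCone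
  ...   | inj₁ (w₀ , w₀-cone) = complete-twin G G∈ G-noCone A (IsIndep-⊆ G A⊆A₀ A₀-indep) ∣A∣ w₀ w₀-cone

theorem3p10 : (a₁ : ℕ) {s : ℕ} (as : Vec ℕ s) (q n r t : ℕ) →
    2 ≤ a₁ → All (1 ≤_) as → 1 ≤ q → 1 ≤ n → 1 ≤ r → 1 ≤ t →
    ∀ {k} (G : Graph k) →
      ((∃ λ k' → Σ (Graph k') λ G' → AlgorithmB.InB a₁ as q n r t G' × Iso G' G)
        ⇔ (InHMaxT (a₁ ∷ as) q n t G × AlphaGe G r))
theorem3p10 a₁ as q n r t 2≤a₁ as≥1 1≤q 1≤n _ 1≤t G =
  mk⇔ (λ (_ , G′ , G′∈B , G′≅G) → sound G′ G G′∈B G′≅G) (λ (G∈ , α≥r) → complete G G∈ α≥r)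
  where open Main a₁ as q n r t 2≤a₁ as≥1 1≤q 1≤n 1≤t
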